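{- For every $\text{rLDL}$ formula $\varphi$ and every $\beta\in\mathbb B_4$ there is an alternating parity automaton $\mathfrak A_{\varphi,\beta}$ over the alphabet $2^P$ with $O(|\varphi|)$ states recognizing the language $\{w\in(2^P)^\omega\mid V(w,\varphi)\succeq\beta\}$.
   Context: Fix a finite non-empty set $P$ of atomic propositions; traces $w\in(2^P)^\omega$, $w[j,\infty)=w(j)w(j+1)\cdots$. $\mathbb{B}_4=\{0000,0001,0011,0111,1111\}$ ordered by $0000 \prec 0001 \prec 0011 \prec 0111 \prec 1111$; over subsets of $\{0,1\}$, $\min\emptyset=1$, $\max\emptyset=0$; $\min,\max$ of truth values are w.r.t. $\preceq$. $\text{rLDL}$ formulas and guards: $\varphi ::= p \mid \neg\varphi \mid \varphi\wedge\varphi\mid\varphi\vee\varphi\mid\varphi\to\varphi\mid \langle\!\langle r\rangle\!\rangle\varphi \mid [\![ r]\!]\varphi$, $r ::= \phi \mid \varphi? \mid r+r \mid r;r \mid r^*$ ($p\in P$, $\phi$ propositional over $P$). The size $|\varphi|$ is the number of distinct subformulas of $\varphi$ (formulas occurring in tests count as subformulas, guards do not) plus the sum of the lengths of the guards occurring in $\varphi$, counted with multiplicity and measured in number of operators. Semantics $V(w,\varphi)\in\mathbb B_4$ with bits $V_i$: $V(w,p)=1111$ if $p\in w(0)$ else $0000$; $V(w,\neg\varphi)=0000$ if $V(w,\varphi)=1111$ else $1111$; $\wedge$ is $\min$, $\vee$ is $\max$; $V(w,\varphi_0\to\varphi_1)=1111$ if $V(w,\varphi_0)\preceq V(w,\varphi_1)$,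 else $V(w,\varphi_1)$. Match sets $\mathcal R_i(w,r)\subseteq\mathbb N$, $i\in\{1,2,3,4\}$: $\mathcal R_i(w,\phi)=\{1\}$ if $w(0)\models\phi$ else $\emptyset$; $\mathcal R_i(w,\psi?)=\{0\}$ if $V_i(w,\psi)=1$ else $\emptyset$; $\mathcal R_i(w,r_0+r_1)=\mathcal R_i(w,r_0)\cup\mathcal R_i(w,r_1)$; $\mathcal R_i(w,r_0;r_1)=\{j_0+j_1\mid j_0\in\mathcal R_i(w,r_0), j_1\in\mathcal R_i(w[j_0,\infty),r_1)\}$; $\mathcal R_i(w,r^*)=\{0\}\cup\{j_1+\cdots+j_\ell\mid\ell\ge1, j_{\ell'}\in\mathcal R_i(w[j_1+\cdots+j_{\ell'-1},\infty),r)\ \forall\ell'\le\ell\}$. $V(w,\langle\!\langle r\rangle\!\rangle\varphi)$ has bits $b_i = \max_{j\in\mathcal R_i(w,r)}V_i(w[j,\infty),\varphi)$. $V(w,[\![ r]\!]\varphi)$ has bits $b_i = \max\{b'_1,\dots,b'_i\}$ where $b'_1 = \min_{j\in\mathcal R_1(w,r)}V_1(w[j,\infty),\varphi)$; $b'_2 = \max_{j'}\min_{j\in\mathcal R_2(w,r), j\ge j'}V_2(w[j,\infty),\varphi)$ if $\mathcal R_2(w,r)$ infinite, $\min_{j\in\mathcal R_2(w,r)}V_2(w[j,\infty),\varphi)$ if finite non-empty, $1$ if empty; $b'_3 = \min_{j'}\max_{j\in\mathcal R_3(w,r),j\ge j'}V_3(w[j,\infty),\varphi)$ if $\mathcal R_3(w,r)$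 infinite, $\max_{j\in\mathcal R_3(w,r)}V_3(w[j,\infty),\varphi)$ if finite non-empty, $1$ if empty; $b'_4 = \max_{j\in\mathcal R_4(w,r)}V_4(w[j,\infty),\varphi)$ if $\mathcal R_4(w,r)\ne\emptyset$, else $1$. An alternating parity automaton $(Q,\Sigma,q_{\mathrm{init}},\delta,\Omega)$ has finite state set $Q$, initial state $q_{\mathrm{init}}$, transition function $\delta:Q\times\Sigma\to\mathcal B^+(Q)$ (positive Boolean combinations of states, including true and false) and coloring $\Omega:Q\to\mathbb N$; it accepts $w$ if there is a run DAG on $w$ all of whose infinite paths satisfy the max-parity condition (the maximal color seen infinitely often is even). -}

module Defs where

open import Data.Nat using (ℕ; zero; suc; _+_; _*_; _≤_; _≥_)
open import Data.Nat.Properties using ()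
open import Data.Bool using (Bool; true; false; T; _∧_; _∨_; not)
open import Data.Fin using (Fin; toℕ) renaming (zero to fz; suc to fs)
import Data.Fin as Fin
open import Data.Fin.Subset using (Subset)
open import Data.Vec using (lookup)
open import Data.List using (List; []; _∷_; _++_; length; deduplicateᵇ)
open import Data.Product using (Σ; ∃; ∃-syntax; _×_; _,_)
open import Data.Sum using (_⊎_)
open import Data.Empty using (⊥)
open import Data.Unit using (⊤)
open import Relation.Nullary using (¬_)
open import Relation.Nullary.Decidable using (⌊_⌋)
open import Relation.Binary.PropositionalEquality using (_≡_)

Letter : ℕ → Set
Letter n = Subset n

Trace : ℕ → Set
Trace n = ℕ → Letter n

suffix : ∀ {n} → ℕ → Trace n → Trace n
suffix j w = λ k → w (j + k)

data PForm (n : ℕ) : Set where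
  ptrue pfalse : PForm n
  pvar : Fin n → PForm n
  pnot : PForm n → PForm n
  pand por : PForm n → PForm n → PForm n

evalP : ∀ {n} → PForm n → Letter n → Bool
evalP ptrue a = true
evalP pfalse a = false
evalP (pvar p) a = lookup a p
evalP (pnot φ) a = not (evalP φ a)
evalP (pand φ ψ) a = evalP φ a ∧ evalP ψ a
evalP (por φ ψ) a = evalP φ a ∨ evalP ψ a

mutual
  data Formula (n : ℕ) : Set where
    atom  : Fin n → Formula n
    neg   : Formula n → Formula n
    conj  : Formula n → Formula n → Formula n
    disj  : Formula n → Formula n → Formula n
    impl  : Formula n → Formula n → Formula n
    dia   : Guard n → Formula n → Formula n
    box   : Guard n → Formula n → Formula n

  data Guard (n : ℕ) : Set where
    gprop : PForm n → Guard n
    gtest : Formula n → Guard n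
    gplus : Guard n → Guard n → Guard n
    gseq  : Guard n → Guard n → Guard n
    gstar : Guard n → Guard n

eqFin : ∀ {n} → Fin n → Fin n → Bool
eqFin x y = ⌊ x Fin.≟ y ⌋

eqP : ∀ {n} → PForm n → PForm n → Bool
eqP ptrue ptrue = true
eqP pfalse pfalse = true
eqP (pvar p) (pvar q) = eqFin p q
eqP (pnot a) (pnot b) = eqP a b
eqP (pand a b) (pand c d) = eqP a c ∧ eqP b d
eqP (por a b) (por c d) = eqP a c ∧ eqP b d
eqP _ _ = false

mutual
  eqF : ∀ {n} → Formula n → Formula n → Bool
  eqF (atom p) (atom q) = eqFin p q
  eqF (neg a) (neg b) = eqF a b
  eqF (conj a b) (conj c d) = eqF a c ∧ eqF b d
  eqF (disj a b) (disj c d) = eqF a c ∧ eqF b d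
  eqF (impl a b) (impl c d) = eqF a c ∧ eqF b d
  eqF (dia r a) (dia s b) = eqG r s ∧ eqF a b
  eqF (box r a) (box s b) = eqG r s ∧ eqF a b
  eqF _ _ = false

  eqG : ∀ {n} → Guard n → Guard n → Bool
  eqG (gprop a) (gprop b) = eqP a b
  eqG (gtest a) (gtest b) = eqF a b
  eqG (gplus r s) (gplus t u) = eqG r t ∧ eqG s u
  eqG (gseq r s) (gseq t u) = eqG r t ∧ eqG s u
  eqG (gstar r) (gstar s) = eqG r s
  eqG _ _ = false

mutual
  subs : ∀ {n} → Formula n → List (Formula n)
  subs φ@(atom _) = φ ∷ []
  subs φ@(neg a) = φ ∷ subs a
  subs φ@(conj a b) = φ ∷ subs a ++ subs b
  subs φ@(disj a b) = φ ∷ subs a ++ subs b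
  subs φ@(impl a b) = φ ∷ subs a ++ subs b
  subs φ@(dia r a) = φ ∷ subsG r ++ subs a
  subs φ@(box r a) = φ ∷ subsG r ++ subs a

  subsG : ∀ {n} → Guard n → List (Formula n)
  subsG (gprop _) = []
  subsG (gtest a) = subs a
  subsG (gplus r s) = subsG r ++ subsG s
  subsG (gseq r s) = subsG r ++ subsG s
  subsG (gstar r) = subsG r

-- length of a guard: number of guard operators (atomic guards φ and
-- tests ψ? count 1 each, as do +, ; and *); the tested formula ψ is
-- accounted for among the subformulas, not here.
glen : ∀ {n} → Guard n → ℕ
glen (gprop _) = 1
glen (gtest _) = 1
glen (gplus r s) = suc (glen r + glen s)
glen (gseq r s) = suc (glen r + glen s)
glen (gstar r) = suc (glen r)

mutual
  guardsLen : ∀ {n} → Formula n → ℕ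
  guardsLen (atom _) = 0
  guardsLen (neg a) = guardsLen a
  guardsLen (conj a b) = guardsLen a + guardsLen b
  guardsLen (disj a b) = guardsLen a + guardsLen b
  guardsLen (impl a b) = guardsLen a + guardsLen b
  guardsLen (dia r a) = glen r + guardsLenG r + guardsLen a
  guardsLen (box r a) = glen r + guardsLenG r + guardsLen a

  guardsLenG : ∀ {n} → Guard n → ℕ
  guardsLenG (gprop _) = 0
  guardsLenG (gtest a) = guardsLen a
  guardsLenG (gplus r s) = guardsLenG r + guardsLenG s
  guardsLenG (gseq r s) = guardsLenG r + guardsLenG s
  guardsLenG (gstar r) = guardsLenG r

size : ∀ {n} → Formula n → ℕ
size φ = length (deduplicateᵇ eqF (subs φ)) + guardsLen φ

-- Truth values B4 = {0000 ≺ 0001 ≺ 0011 ≺ 0111 ≺ 1111}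

data B4 : Set where
  v0000 v0001 v0011 v0111 v1111 : B4

-- bit i (i = 0,1,2,3 stands for the paper's bits 1,2,3,4)
bit : B4 → Fin 4 → Bool
bit v0000 _ = false
bit v0001 (fs (fs (fs fz))) = true
bit v0001 _ = false
bit v0011 fz = false
bit v0011 (fs fz) = false
bit v0011 _ = true
bit v0111 fz = false
bit v0111 _ = true
bit v1111 _ = true

-- Semantics, bitwise:  Sem i w φ  ⇔  V_{i+1}(w,φ) = 1
--                     Match i w r j ⇔  j ∈ R_{i+1}(w,r)

psum : ∀ {ℓ} → (Fin ℓ → ℕ) → Fin ℓ → ℕ
psum js fz = 0
psum js (fs k) = js fz + psum (λ x → js (fs x)) k

total : ∀ {ℓ} → (Fin ℓ → ℕ) → ℕ
total {zero} js = 0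
total {suc ℓ} js = js fz + total (λ x → js (fs x))

Infinite : (ℕ → Set) → Set
Infinite R = ∀ N → ∃[ j ] (j ≥ N × R j)

mutual
  Sem : ∀ {n} → Fin 4 → Trace n → Formula n → Set
  Sem i w (atom p) = T (lookup (w 0) p)
  Sem i w (neg φ) = ¬ (∀ k → Sem k w φ)           -- V(w,φ) ≠ 1111
  Sem i w (conj φ ψ) = Sem i w φ × Sem i w ψ
  Sem i w (disj φ ψ) = Sem i w φ ⊎ Sem i w ψ
  Sem i w (impl φ ψ) = (∀ k → Sem k w φ → Sem k w ψ) ⊎ Sem i w ψ
  Sem i w (dia r φ) = ∃[ j ] (Match i w r j × Sem i (suffix j w) φ)
  Sem i w (box r φ) = ∃[ k ] (toℕ k ≤ toℕ i × BoxBit k w r φ)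

  -- the auxiliary bits b'_{k+1} of [[ r ]] φ
  BoxBit : ∀ {n} → Fin 4 → Trace n → Guard n → Formula n → Set
  BoxBit fz w r φ =
    ∀ j → Match fz w r j → Sem fz (suffix j w) φ
  BoxBit k@(fs fz) w r φ =
      (Infinite (Match k w r) ×
        ∃[ j' ] (∀ j → j ≥ j' → Match k w r j → Sem k (suffix j w) φ))
    ⊎ (¬ Infinite (Match k w r) ×
        (∀ j → Match k w r j → Sem k (suffix j w) φ))
  BoxBit k@(fs (fs fz)) w r φ =
      (Infinite (Match k w r) ×
        (∀ j' → ∃[ j ] (j ≥ j' × Match k w r j × Sem k (suffix j w) φ)))
    ⊎ (¬ Infinite (Match k w r) ×
        ((∃[ j ] (Match k w r j × Sem k (suffix j w) φ))
         ⊎ ¬ (∃[ j ] Match k w r j)))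
  BoxBit k@(fs (fs (fs fz))) w r φ =
      (∃[ j ] (Match k w r j × Sem k (suffix j w) φ))
    ⊎ ¬ (∃[ j ] Match k w r j)

  Match : ∀ {n} → Fin 4 → Trace n → Guard n → ℕ → Set
  Match i w (gprop φ) j = j ≡ 1 × T (evalP φ (w 0))
  Match i w (gtest ψ) j = j ≡ 0 × Sem i w ψ
  Match i w (gplus r s) j = Match i w r j ⊎ Match i w s j
  Match i w (gseq r s) j =
    ∃[ j₀ ] ∃[ j₁ ] (Match i w r j₀ × Match i (suffix j₀ w) s j₁ × j ≡ j₀ + j₁)
  Match i w (gstar r) j =
    ∃[ ℓ ] Σ (Fin ℓ → ℕ) λ js →
      (∀ k → Match i (suffix (psum js k) w) r (js k)) × j ≡ total js

_⊨_⪰_ : ∀ {n} → Trace n → Formula n → B4 → Set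
w ⊨ φ ⪰ β = ∀ i → T (bit β i) → Sem i w φ

data PosBool (Q : Set) : Set where
  btrue bfalse : PosBool Q
  bstate : Q → PosBool Q
  band bor : PosBool Q → PosBool Q → PosBool Q

_⊩_ : ∀ {Q : Set} → (Q → Bool) → PosBool Q → Set
S ⊩ btrue = ⊤
S ⊩ bfalse = ⊥
S ⊩ bstate q = T (S q)
S ⊩ band a b = (S ⊩ a) × (S ⊩ b)
S ⊩ bor a b = (S ⊩ a) ⊎ (S ⊩ b)

record APA (n : ℕ) : Set where
  field
    states : ℕ
    qinit  : Fin states
    δ      : Fin states → Letter n → PosBool (Fin states)
    Ω      : Fin states → ℕ

open APA public

-- run DAG: vertices V k (level k), edges E k q q' from (k,q) to (k+1,q')
record RunDAG {n} (A : APA n) (w : Trace n) : Set where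
  field
    V : ℕ → Fin (states A) → Bool
    E : ℕ → Fin (states A) → Fin (states A) → Bool
    root  : T (V 0 (qinit A))
    edges : ∀ k q q' → T (E k q q') → T (V k q) × T (V (suc k) q')
    trans : ∀ k q → T (V k q) → (λ q' → E k q q') ⊩ δ A q (w k)

open RunDAG public

IsPath : ∀ {n} {A : APA n} {w : Trace n} → RunDAG A w → (ℕ → Fin (states A)) → Set
IsPath {A = A} G π = π 0 ≡ qinit A × (∀ k → T (E G k (π k) (π (suc k))))

Even : ℕ → Set
Even m = ∃[ h ] (m ≡ h + h)

-- max-parity: the maximal colour seen infinitely often is even
MaxParity : (ℕ → ℕ) → Set
MaxParity col = ∃[ c ] (Even c
  × (∀ k → ∃[ k' ] (k' ≥ k × col k' ≡ c))
  × ∃[ k ] (∀ k' → k' ≥ k → col k' ≤ c))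

Accepts : ∀ {n} → APA n → Trace n → Set
Accepts A w = Σ (RunDAG A w) λ G →
  ∀ π → IsPath G π → MaxParity (λ k → Ω A (π k))

-- Each bit of the truth value is unfolded letter by letter: a guard is unfolded into a derivative-like
-- branching whose leaves are its letters, and besides an initial state the states of the automaton
-- are these letter positions, tagged with a bit, a condition on the end of the match, a once/often
-- mode and a polarity. Acceptance is decided without building runs: the (classical) truth of every
-- state at every position is a marking consistent with the transitions. Along successors respecting
-- the marking the syntactic rank never increases, and while it stays put the colour stays put and, if
-- odd, a progress measure shrinks (the distance to the first end of a pending match, or to the last
-- end of a refuted infinite one); so the run built from the marking is accepting. If the value is not
-- above the threshold, the dual marking holds initially and forces an odd stable colour on some path
-- of every run.

module Submission where

open import Defs
open import Level using (0ℓ)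
open import Axiom.ExcludedMiddle using (ExcludedMiddle)
open import Axiom.DoubleNegationElimination using (em⇒dne)
open import Data.Bool using (Bool; true; false; T; not; _∧_; if_then_else_)
open import Data.Bool.Properties using (T-∧; T?; not-involutive)
open import Data.Empty using (⊥; ⊥-elim)
open import Data.Fin using (Fin; toℕ) renaming (zero to fz; suc to fs)
open import Data.Nat using (ℕ; zero; suc; _+_; _*_; _∸_; _≤_; _<_; _≥_; z≤n; s≤s; s≤s⁻¹; _⊔_)
open import Data.Nat.Properties
open import Data.Nat.Induction using (<-wellFounded)
open import Data.Product using (Σ; ∃; ∃-syntax; _×_; _,_; proj₁; proj₂)
open import Data.Sum using (_⊎_; inj₁; inj₂)
open import Data.Unit using (⊤; tt)
open import Data.List using (List; []; _∷_; _++_; map; length; cartesianProduct; allFin; deduplicateᵇ)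
import Data.List as List
open import Data.List.Properties using (length-map; length-++)
open import Data.List.Membership.Propositional using (_∈_)
open import Data.List.Membership.Propositional.Properties using (∈-map⁺; ∈-++⁺ˡ; ∈-++⁺ʳ; ∈-allFin; ∈-cartesianProduct⁺)
open import Data.List.Relation.Unary.Any using (here; there; index)
open import Data.List.Relation.Unary.Any.Properties using (lookup-index)
open import Data.Vec using (lookup)
open import Function.Base using (_∘_; id)
open import Function.Bundles using (_⇔_; mk⇔; module Equivalence)
open import Function.Related.TypeIsomorphisms using (¬-cong-⇔)
open import Function.Properties.Equivalence using () renaming (refl to ⇔-refl; sym to ⇔-sym; trans to ⇔-trans)
open import Data.Product.Function.NonDependent.Propositional using (_×-⇔_)
open import Data.Sum.Function.Propositional using (_⊎-⇔_)
open import Induction.InfiniteDescent using (InfiniteDescendingSequence; Descent; descent∧wf⇒empty)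
open import Induction.WellFounded using (Acc; acc)
open import Relation.Binary.PropositionalEquality as ≡ using (_≡_; refl; sym; cong; cong₂; subst; subst₂)
open import Relation.Nullary using (¬_; Dec; yes; no)
open import Relation.Nullary.Decidable using (⌊_⌋; toWitness; fromWitness)

open Equivalence using (to; from)

private
  variable
    n : ℕ
    Q R X L : Set

-- Natural numbers and infinite sets

antitone-from-step : (f : ℕ → ℕ) → (∀ k → f (suc k) ≤ f k) → ∀ {j k} → j ≤ k → f k ≤ f j
antitone-from-step f step {k = zero} z≤n = ≤-refl
antitone-from-step f step {j} {suc k} j≤1+k with m≤n⇒m<n∨m≡n j≤1+k
... | inj₁ j<1+k = ≤-trans (step k) (antitone-from-step f step (s≤s⁻¹ j<1+k))
... | inj₂ refl = ≤-refl

induction-from : {P : ℕ → Set} (K : ℕ) → P K → (∀ k → k ≥ K → P k → P (suc k)) → ∀ k → k ≥ K → P k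
induction-from K base step k K≤k with m≤n⇒m<n∨m≡n K≤k
... | inj₂ refl = base
... | inj₁ (s≤s K≤k') = step _ K≤k' (induction-from K base step _ K≤k')

no-infinite-descent : (f : ℕ → ℕ) → ¬ InfiniteDescendingSequence _<_ f
no-infinite-descent f desc = descent∧wf⇒empty descent <-wellFounded (f 0) (0 , refl)
  where
  descent : Descent _<_ (λ x → ∃[ k ] f k ≡ x)
  descent (k , refl) = f (suc k) , desc k , suc k , refl

∸-shrinks : ∀ {j' j k} → j' ≤ j → suc k ≤ j → j' ∸ suc k < j ∸ k
∸-shrinks {k = k} j'≤j k<j = ≤-<-trans (∸-monoˡ-≤ (suc k) j'≤j) (∸-monoʳ-< (n<1+n k) k<j)

≤-suc-+ˡ : ∀ a b → a ≤ suc (a + b)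
≤-suc-+ˡ a b = m≤n⇒m≤1+n (m≤m+n a b)

≤-suc-+ʳ : ∀ a b → b ≤ suc (a + b)
≤-suc-+ʳ a b = m≤n⇒m≤1+n (m≤n+m b a)

2+2*-mono : ∀ {a b} → a ≤ b → 2 + 2 * a ≤ 2 + 2 * b
2+2*-mono a≤b = +-monoʳ-≤ 2 (*-monoʳ-≤ 2 a≤b)

¬Even-1 : ¬ Even 1
¬Even-1 (zero , ())
¬Even-1 (suc h , e) = 1+n≢0 (sym (≡.trans (suc-injective e) (+-suc h h)))

T-not : ∀ b → T (not b) ⇔ (¬ T b)
T-not true = mk⇔ (λ ()) (λ ¬t → ¬t tt)
T-not false = mk⇔ (λ _ ()) (λ _ → tt)

∀-cong : ∀ {m} {A B : Fin m → Set} → (∀ j → A j ⇔ B j) → (∀ j → A j) ⇔ (∀ j → B j)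
∀-cong h = mk⇔ (λ a j → to (h j) (a j)) (λ b j → from (h j) (b j))

Infinite-mono : {P P' : ℕ → Set} → (∀ j → P j → P' j) → Infinite P → Infinite P'
Infinite-mono h inf N = let (j , j≥N , p) = inf N in j , j≥N , h j p

Infinite-cong : {P P' : ℕ → Set} → (∀ j → P j ⇔ P' j) → Infinite P ⇔ Infinite P'
Infinite-cong h = mk⇔ (Infinite-mono (to ∘ h)) (Infinite-mono (from ∘ h))

Infinite-shift : ∀ k (A B : ℕ → Set) →
  Infinite (λ t → A t × B (k + t)) ⇔ Infinite (λ p → ∃[ t ] (A t × k + t ≡ p × B (k + t)))
Infinite-shift k A B = mk⇔ forth back
  where
  forth : Infinite (λ t → A t × B (k + t)) → Infinite (λ p → ∃[ t ] (A t × k + t ≡ p × B (k + t)))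
  forth inf N = let (t , t≥N , a , b) = inf N in k + t , ≤-trans t≥N (m≤n+m t k) , t , a , refl , b
  back : Infinite (λ p → ∃[ t ] (A t × k + t ≡ p × B (k + t))) → Infinite (λ t → A t × B (k + t))
  back inf N with inf (k + N)
  ... | _ , k+t≥k+N , t , a , refl , b = t , +-cancelˡ-≤ k N t k+t≥k+N , a , b

¬Infinite-singleton : ∀ k (C : Set) → ¬ Infinite (λ j → k ≡ j × C)
¬Infinite-singleton k C inf with inf (suc k)
... | _ , k<k , refl , _ = <-irrefl refl k<k

dependent-choice : {A : Set} (Inv : ℕ → A → Set) (R : ℕ → A → A → Set) {a₀ : A} → Inv 0 a₀ →
  (∀ k a → Inv k a → ∃[ a' ] (R k a a' × Inv (suc k) a')) →
  ∃[ π ] (π 0 ≡ a₀ × (∀ k → R k (π k) (π (suc k))))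
dependent-choice {A} Inv R {a₀} inv₀ step = proj₁ ∘ walk , refl , λ k → proj₁ (proj₂ (next k))
  where
  walk : ∀ k → Σ A (Inv k)
  next : ∀ k → ∃[ a' ] (R k (proj₁ (walk k)) a' × Inv (suc k) a')
  walk zero = a₀ , inv₀
  walk (suc k) = proj₁ (next k) , proj₂ (proj₂ (next k))
  next k = step k (proj₁ (walk k)) (proj₂ (walk k))

module Classical (em : ExcludedMiddle 0ℓ) where

  dne : {A : Set} → ¬ ¬ A → A
  dne = em⇒dne em

  →⇔¬⊎ : {A B : Set} → (A → B) ⇔ (¬ A ⊎ B)
  →⇔¬⊎ {A} {B} = mk⇔ split join
    where
    split : (A → B) → ¬ A ⊎ B
    split f with em {A}
    ... | yes a = inj₂ (f a)
    ... | no ¬a = inj₁ ¬a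
    join : ¬ A ⊎ B → A → B
    join (inj₁ ¬a) a = ⊥-elim (¬a a)
    join (inj₂ b) _ = b

  ¬Infinite⇒bounded : {P : ℕ → Set} → ¬ Infinite P → ∃[ N ] (∀ j → j ≥ N → ¬ P j)
  ¬Infinite⇒bounded ¬inf =
    dne λ unbounded → ¬inf λ N → dne λ ¬above → unbounded (N , λ j j≥N p → ¬above (j , j≥N , p))

  Infinite-⊎ : {P Q : ℕ → Set} → Infinite (λ j → P j ⊎ Q j) → Infinite P ⊎ Infinite Q
  Infinite-⊎ {P} {Q} inf with em {Infinite P}
  ... | yes infP = inj₁ infP
  ... | no ¬infP = inj₂ infQ
    where
    infQ : Infinite Q
    infQ N with ¬Infinite⇒bounded ¬infP
    ... | N₀ , noP with inf (N ⊔ N₀)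
    ...   | j , j≥ , inj₁ p = ⊥-elim (noP j (≤-trans (m≤n⊔m N N₀) j≥) p)
    ...   | j , j≥ , inj₂ q = j , ≤-trans (m≤m⊔n N N₀) j≥ , q

  least : {P : ℕ → Set} → ∃ P → ∃[ j ] (P j × (∀ j' → P j' → j ≤ j'))
  least {P} (j , p) = go j (<-wellFounded j) p
    where
    go : ∀ j → Acc _<_ j → P j → ∃[ j ] (P j × (∀ j' → P j' → j ≤ j'))
    go j (acc smaller) p with em {∃[ j' ] (j' < j × P j')}
    ... | yes (j' , j'<j , p') = go j' (smaller j'<j) p'
    ... | no none = j , p , λ j' p' → ≮⇒≥ (λ j'<j → none (j' , j'<j , p'))

  -- The least value of f is attained at some K and kept from then on.
  antitone⇒eventually-constant : (f : ℕ → ℕ) → (∀ k → f (suc k) ≤ f k) →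
    ∃[ K ] (∀ k → k ≥ K → f k ≡ f K)
  antitone⇒eventually-constant f step with least {λ v → ∃[ k ] f k ≡ v} (f 0 , 0 , refl)
  ... | _ , (K , refl) , minimal =
    K , λ k k≥K → ≤-antisym (antitone-from-step f step k≥K) (minimal (f k) (k , refl))

  -- The least element of P (junk value 0 when P is empty).
  μ : (ℕ → Set) → ℕ
  μ P with em {∃ P}
  ... | yes e = proj₁ (least e)
  ... | no _ = 0

  μ-minimal : {P : ℕ → Set} → ∃ P → P (μ P) × (∀ j → P j → μ P ≤ j)
  μ-minimal {P} e with em {∃ P}
  ... | yes e' = proj₂ (least e')
  ... | no ¬e = ⊥-elim (¬e e)

-- Positive Boolean formulas

rename : (Q → R) → PosBool Q → PosBool R
rename f btrue = btrue
rename f bfalse = bfalse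
rename f (bstate q) = bstate (f q)
rename f (band a b) = band (rename f a) (rename f b)
rename f (bor a b) = bor (rename f a) (rename f b)

dual : (Q → R) → PosBool Q → PosBool R
dual f btrue = bfalse
dual f bfalse = btrue
dual f (bstate q) = bstate (f q)
dual f (band a b) = bor (dual f a) (dual f b)
dual f (bor a b) = band (dual f a) (dual f b)

bind : PosBool Q → (Q → PosBool R) → PosBool R
bind btrue f = btrue
bind bfalse f = bfalse
bind (bstate q) f = f q
bind (band a b) f = band (bind a f) (bind b f)
bind (bor a b) f = bor (bind a f) (bind b f)

⟦_⟧ : PosBool Q → (Q → Set) → Set
⟦ btrue ⟧ τ = ⊤
⟦ bfalse ⟧ τ = ⊥
⟦ bstate q ⟧ τ = τ q
⟦ band a b ⟧ τ = ⟦ a ⟧ τ × ⟦ b ⟧ τ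
⟦ bor a b ⟧ τ = ⟦ a ⟧ τ ⊎ ⟦ b ⟧ τ

Every : (Q → Set) → PosBool Q → Set
Every P btrue = ⊤
Every P bfalse = ⊤
Every P (bstate q) = P q
Every P (band a b) = Every P a × Every P b
Every P (bor a b) = Every P a × Every P b

⟦⟧-mono : ∀ (X : PosBool Q) {τ τ' : Q → Set} → (∀ q → τ q → τ' q) → ⟦ X ⟧ τ → ⟦ X ⟧ τ'
⟦⟧-mono btrue h p = tt
⟦⟧-mono (bstate q) h p = h q p
⟦⟧-mono (band a b) h (p , p') = ⟦⟧-mono a h p , ⟦⟧-mono b h p'
⟦⟧-mono (bor a b) h (inj₁ p) = inj₁ (⟦⟧-mono a h p)
⟦⟧-mono (bor a b) h (inj₂ p) = inj₂ (⟦⟧-mono b h p)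

⊩⇔⟦⟧ : (S : Q → Bool) (X : PosBool Q) → S ⊩ X ⇔ ⟦ X ⟧ (T ∘ S)
⊩⇔⟦⟧ S X = mk⇔ (forth X) (back X)
  where
  forth : ∀ X → S ⊩ X → ⟦ X ⟧ (T ∘ S)
  forth btrue p = tt
  forth (bstate q) p = p
  forth (band a b) (p , p') = forth a p , forth b p'
  forth (bor a b) (inj₁ p) = inj₁ (forth a p)
  forth (bor a b) (inj₂ p) = inj₂ (forth b p)
  back : ∀ X → ⟦ X ⟧ (T ∘ S) → S ⊩ X
  back btrue p = tt
  back (bstate q) p = p
  back (band a b) (p , p') = back a p , back b p'
  back (bor a b) (inj₁ p) = inj₁ (back a p)
  back (bor a b) (inj₂ p) = inj₂ (back b p)

⊩-mono : ∀ (X : PosBool Q) {S S' : Q → Bool} → (∀ q → T (S q) → T (S' q)) → S ⊩ X → S' ⊩ X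
⊩-mono X {S} {S'} h p = from (⊩⇔⟦⟧ S' X) (⟦⟧-mono X h (to (⊩⇔⟦⟧ S X) p))

⊩-mono-Every : ∀ (X : PosBool Q) {P : Q → Set} {S S' : Q → Bool} → Every P X →
  (∀ q → P q → T (S q) → T (S' q)) → S ⊩ X → S' ⊩ X
⊩-mono-Every btrue ev h p = tt
⊩-mono-Every (bstate q) ev h p = h q ev p
⊩-mono-Every (band a b) (ev , ev') h (p , p') = ⊩-mono-Every a ev h p , ⊩-mono-Every b ev' h p'
⊩-mono-Every (bor a b) (ev , ev') h (inj₁ p) = inj₁ (⊩-mono-Every a ev h p)
⊩-mono-Every (bor a b) (ev , ev') h (inj₂ p) = inj₂ (⊩-mono-Every b ev' h p)

Every-mono : ∀ (X : PosBool Q) {P P' : Q → Set} → (∀ q → P q → P' q) → Every P X → Every P' X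
Every-mono btrue h ev = tt
Every-mono bfalse h ev = tt
Every-mono (bstate q) h ev = h q ev
Every-mono (band a b) h (ev , ev') = Every-mono a h ev , Every-mono b h ev'
Every-mono (bor a b) h (ev , ev') = Every-mono a h ev , Every-mono b h ev'

Every-dual : ∀ (X : PosBool Q) {f : Q → Q} {P : Q → Set} → (∀ q → P q → P (f q)) →
  Every P X → Every P (dual f X)
Every-dual btrue h ev = tt
Every-dual bfalse h ev = tt
Every-dual (bstate q) h ev = h q ev
Every-dual (band a b) h (ev , ev') = Every-dual a h ev , Every-dual b h ev'
Every-dual (bor a b) h (ev , ev') = Every-dual a h ev , Every-dual b h ev'

_⊩?_ : (S : Q → Bool) (X : PosBool Q) → Dec (S ⊩ X)
S ⊩? btrue = yes tt
S ⊩? bfalse = no λ ()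
S ⊩? bstate q with S q
... | true = yes tt
... | false = no λ ()
S ⊩? band a b with S ⊩? a | S ⊩? b
... | yes p | yes p' = yes (p , p')
... | no ¬p | _ = no (¬p ∘ proj₁)
... | _ | no ¬p' = no (¬p' ∘ proj₂)
S ⊩? bor a b with S ⊩? a | S ⊩? b
... | yes p | _ = yes (inj₁ p)
... | _ | yes p' = yes (inj₂ p')
... | no ¬p | no ¬p' = no λ { (inj₁ p) → ¬p p ; (inj₂ p') → ¬p' p' }

⊩-dual : ∀ (S : Q → Bool) {f : Q → Q} → (∀ q → T (S (f q)) ⇔ (¬ T (S q))) →
  ∀ X → S ⊩ dual f X ⇔ (¬ S ⊩ X)
⊩-dual S h btrue = mk⇔ (λ ()) (λ ¬t → ¬t tt)
⊩-dual S h bfalse = mk⇔ (λ _ ()) (λ _ → tt)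
⊩-dual S h (bstate q) = h q
⊩-dual S h (band a b) = mk⇔ forth back
  where
  forth : S ⊩ dual _ a ⊎ S ⊩ dual _ b → ¬ (S ⊩ a × S ⊩ b)
  forth (inj₁ d) (p , _) = to (⊩-dual S h a) d p
  forth (inj₂ d) (_ , p) = to (⊩-dual S h b) d p
  back : ¬ (S ⊩ a × S ⊩ b) → S ⊩ dual _ a ⊎ S ⊩ dual _ b
  back ¬ab with S ⊩? a
  ... | no ¬p = inj₁ (from (⊩-dual S h a) ¬p)
  ... | yes p = inj₂ (from (⊩-dual S h b) (λ p' → ¬ab (p , p')))
⊩-dual S h (bor a b) = mk⇔
  (λ { (d , d') (inj₁ p) → to (⊩-dual S h a) d p ; (d , d') (inj₂ p) → to (⊩-dual S h b) d' p })
  (λ ¬ab → from (⊩-dual S h a) (¬ab ∘ inj₁) , from (⊩-dual S h b) (¬ab ∘ inj₂))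

⊩-dual-complement : ∀ (S : Q → Bool) {f : Q → Q} X → ¬ ((not ∘ S ∘ f) ⊩ X) → S ⊩ dual f X
⊩-dual-complement S btrue ¬p = ¬p tt
⊩-dual-complement S bfalse ¬p = tt
⊩-dual-complement S {f} (bstate q) ¬p with S (f q)
... | true = tt
... | false = ¬p tt
⊩-dual-complement S {f} (band a b) ¬p with (not ∘ S ∘ f) ⊩? a
... | yes p = inj₂ (⊩-dual-complement S b (λ p' → ¬p (p , p')))
... | no ¬p' = inj₁ (⊩-dual-complement S a ¬p')
⊩-dual-complement S (bor a b) ¬p =
  ⊩-dual-complement S a (¬p ∘ inj₁) , ⊩-dual-complement S b (¬p ∘ inj₂)

⊩-dual-meet : (f : Q → R) (S : Q → Bool) (P : R → Bool) (X : PosBool Q) →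
  S ⊩ X → P ⊩ dual f X → ∃[ q ] (T (S q) × T (P (f q)))
⊩-dual-meet f S P (bstate q) s p = q , s , p
⊩-dual-meet f S P (band a b) (s , _) (inj₁ p) = ⊩-dual-meet f S P a s p
⊩-dual-meet f S P (band a b) (_ , s) (inj₂ p) = ⊩-dual-meet f S P b s p
⊩-dual-meet f S P (bor a b) (inj₁ s) (p , _) = ⊩-dual-meet f S P a s p
⊩-dual-meet f S P (bor a b) (inj₂ s) (_ , p) = ⊩-dual-meet f S P b s p

⊩-rename : (f : Q → R) (S : R → Bool) (X : PosBool Q) → S ⊩ rename f X ⇔ (S ∘ f) ⊩ X
⊩-rename f S X = mk⇔ (forth X) (back X)
  where
  forth : ∀ X → S ⊩ rename f X → (S ∘ f) ⊩ X
  forth btrue p = tt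
  forth (bstate q) p = p
  forth (band a b) (p , p') = forth a p , forth b p'
  forth (bor a b) (inj₁ p) = inj₁ (forth a p)
  forth (bor a b) (inj₂ p) = inj₂ (forth b p)
  back : ∀ X → (S ∘ f) ⊩ X → S ⊩ rename f X
  back btrue p = tt
  back (bstate q) p = p
  back (band a b) (p , p') = back a p , back b p'
  back (bor a b) (inj₁ p) = inj₁ (back a p)
  back (bor a b) (inj₂ p) = inj₂ (back b p)

⊩-bind : (S : R → Bool) (X : PosBool Q) (f : Q → PosBool R) →
  S ⊩ bind X f ⇔ ⟦ X ⟧ (λ q → S ⊩ f q)
⊩-bind S X f = mk⇔ (forth X) (back X)
  where
  forth : ∀ X → S ⊩ bind X f → ⟦ X ⟧ (λ q → S ⊩ f q)
  forth btrue p = tt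
  forth (bstate q) p = p
  forth (band a b) (p , p') = forth a p , forth b p'
  forth (bor a b) (inj₁ p) = inj₁ (forth a p)
  forth (bor a b) (inj₂ p) = inj₂ (forth b p)
  back : ∀ X → ⟦ X ⟧ (λ q → S ⊩ f q) → S ⊩ bind X f
  back btrue p = tt
  back (bstate q) p = p
  back (band a b) (p , p') = back a p , back b p'
  back (bor a b) (inj₁ p) = inj₁ (back a p)
  back (bor a b) (inj₂ p) = inj₂ (back b p)

Every-bind : {P : R → Set} (X : PosBool Q) (f : Q → PosBool R) →
  (∀ q → Every P (f q)) → Every P (bind X f)
Every-bind btrue f h = tt
Every-bind bfalse f h = tt
Every-bind (bstate q) f h = h q
Every-bind (band a b) f h = Every-bind a f h , Every-bind b f h
Every-bind (bor a b) f h = Every-bind a f h , Every-bind b f h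

⋀ : ∀ {m} → (Fin m → PosBool Q) → PosBool Q
⋀ {m = zero} f = btrue
⋀ {m = suc m} f = band (f fz) (⋀ (f ∘ fs))

⊩-⋀ : ∀ {m} (S : Q → Bool) (f : Fin m → PosBool Q) → S ⊩ ⋀ f ⇔ (∀ j → S ⊩ f j)
⊩-⋀ {m = zero} S f = mk⇔ (λ _ ()) (λ _ → tt)
⊩-⋀ {m = suc m} S f = mk⇔
  (λ { (p , ps) fz → p ; (p , ps) (fs j) → to (⊩-⋀ S (f ∘ fs)) ps j })
  (λ ps → ps fz , from (⊩-⋀ S (f ∘ fs)) (ps ∘ fs))

Every-⋀ : ∀ {m} {P : Q → Set} (f : Fin m → PosBool Q) → (∀ j → Every P (f j)) → Every P (⋀ f)
Every-⋀ {m = zero} f h = tt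
Every-⋀ {m = suc m} f h = h fz , Every-⋀ (f ∘ fs) (h ∘ fs)

⋁≤ : ∀ {m} → (Fin (suc m) → PosBool Q) → Fin (suc m) → PosBool Q
⋁≤ f fz = f fz
⋁≤ {m = suc m} f (fs i) = bor (f fz) (⋁≤ (f ∘ fs) i)

⊩-⋁≤ : ∀ {m} (S : Q → Bool) (f : Fin (suc m) → PosBool Q) i →
  S ⊩ ⋁≤ f i ⇔ (∃[ j ] (toℕ j ≤ toℕ i × S ⊩ f j))
⊩-⋁≤ S f fz = mk⇔ (λ p → fz , z≤n , p) (λ { (fz , _ , p) → p })
⊩-⋁≤ {m = suc m} S f (fs i) = mk⇔ forth back
  where
  forth : S ⊩ f fz ⊎ S ⊩ ⋁≤ (f ∘ fs) i → ∃[ j ] (toℕ j ≤ toℕ (fs i) × S ⊩ f j)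
  forth (inj₁ p) = fz , z≤n , p
  forth (inj₂ p) with to (⊩-⋁≤ S (f ∘ fs) i) p
  ... | j , j≤i , p' = fs j , s≤s j≤i , p'
  back : ∃[ j ] (toℕ j ≤ toℕ (fs i) × S ⊩ f j) → S ⊩ f fz ⊎ S ⊩ ⋁≤ (f ∘ fs) i
  back (fz , _ , p) = inj₁ p
  back (fs j , s≤s j≤i , p) = inj₂ (from (⊩-⋁≤ S (f ∘ fs) i) (j , j≤i , p))

Every-⋁≤ : ∀ {m} {P : Q → Set} (f : Fin (suc m) → PosBool Q) → (∀ j → Every P (f j)) →
  ∀ i → Every P (⋁≤ f i)
Every-⋁≤ f h fz = h fz
Every-⋁≤ {m = suc m} f h (fs i) = h fz , Every-⋁≤ (f ∘ fs) (h ∘ fs) i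

⊩-if : ∀ (S : Q → Bool) b → S ⊩ (if b then btrue else bfalse) ⇔ T b
⊩-if S true = ⇔-refl
⊩-if S false = ⇔-refl

⊩-if-else-true : ∀ (S : Q → Bool) b X → S ⊩ (if b then X else btrue) ⇔ (T b → S ⊩ X)
⊩-if-else-true S true X = mk⇔ (λ p _ → p) (λ f → f tt)
⊩-if-else-true S false X = mk⇔ (λ _ ()) (λ _ → tt)

Every-if : ∀ {P : Q → Set} b → Every P (if b then btrue else bfalse)
Every-if true = tt
Every-if false = tt

-- Acceptance from a consistent marking

GoodSuccessor : {St : Set} → (ℕ → St → Bool) → (St → ℕ) → (St → ℕ) → (ℕ → St → ℕ) → ℕ → St → St → Set
GoodSuccessor holds rank colour progress k q q' = T (holds (suc k) q') × rank q' ≤ rank q ×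
  (rank q' ≡ rank q → colour q' ≡ colour q × (¬ Even (colour q) → progress (suc k) q' < progress k q))

-- A marking [holds] of the states at each position certifies acceptance if every marked state's
-- transition is satisfied by its good successors, and refutes it if the same holds for the dual marking.
module AcceptanceCriterion (em : ExcludedMiddle 0ℓ) {n : ℕ} (A : APA n) (w : Trace n)
  (holds : ℕ → Fin (states A) → Bool) (dualState : Fin (states A) → Fin (states A))
  (rank : Fin (states A) → ℕ) (progress : ℕ → Fin (states A) → ℕ) where

  open Classical em

  State : Set
  State = Fin (states A)

  Good : ℕ → State → State → Set
  Good = GoodSuccessor holds rank (Ω A) progress

  good : ℕ → State → State → Bool
  good k q q' = ⌊ em {Good k q q'} ⌋

  GoodPath : (ℕ → State) → Set
  GoodPath π = ∀ k → T (good k (π k) (π (suc k)))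

  good-path-stabilises : ∀ π → GoodPath π →
    ∃[ K ] (Even (Ω A (π K)) × (∀ k → k ≥ K → Ω A (π k) ≡ Ω A (π K)))
  good-path-stabilises π good-π = K , even , colour-const
    where
    step : ∀ k → Good k (π k) (π (suc k))
    step k = toWitness (good-π k)
    rank-const = antitone⇒eventually-constant (rank ∘ π) (λ k → proj₁ (proj₂ (step k)))
    K = proj₁ rank-const
    same-rank : ∀ k → k ≥ K → rank (π (suc k)) ≡ rank (π k)
    same-rank k k≥K = ≡.trans (proj₂ rank-const (suc k) (m≤n⇒m≤1+n k≥K)) (sym (proj₂ rank-const k k≥K))
    colour-const : ∀ k → k ≥ K → Ω A (π k) ≡ Ω A (π K)
    colour-const = induction-from K refl λ k k≥K eq →
      ≡.trans (proj₁ (proj₂ (proj₂ (step k)) (same-rank k k≥K))) eq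
    -- an odd stable colour would make progress (d + K) (π (d + K)) descend forever
    even : Even (Ω A (π K))
    even = dne λ odd → no-infinite-descent (λ d → progress (d + K) (π (d + K))) λ d →
      proj₂ (proj₂ (proj₂ (step (d + K))) (same-rank (d + K) (m≤n+m K d)))
        (odd ∘ subst Even (colour-const (d + K) (m≤n+m K d)))

  good-path-accepting : ∀ π → GoodPath π → MaxParity (Ω A ∘ π)
  good-path-accepting π good-π with good-path-stabilises π good-π
  ... | K , even , const = Ω A (π K) , even ,
    (λ k → k + K , m≤m+n k K , const (k + K) (m≤n+m K k)) , K , λ k k≥K → ≤-reflexive (const k k≥K)

  module _
    (init-or-dual : ¬ T (holds 0 (qinit A)) → T (holds 0 (dualState (qinit A))))
    (δ-dual : ∀ k q (S P : State → Bool) → S ⊩ δ A q (w k) → P ⊩ δ A (dualState q) (w k) →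
      ∃[ q' ] (T (S q') × T (P (dualState q'))))
    (Ω-dual : ∀ q → Even (Ω A (dualState q)) → ¬ Even (Ω A q))
    (consistent : ∀ k q → T (holds k q) → good k q ⊩ δ A q (w k)) where

    holds⇒accepts : T (holds 0 (qinit A)) → Accepts A w
    holds⇒accepts h = G , λ π (_ , edges-π) → good-path-accepting π
      (λ k → proj₂ (to (T-∧ {holds k (π k)}) (edges-π k)))
      where
      G : RunDAG A w
      G = record
        { V = holds
        ; E = λ k q q' → holds k q ∧ good k q q'
        ; root = h
        ; edges = λ k q q' e →
            proj₁ (to (T-∧ {holds k q}) e) , proj₁ (toWitness (proj₂ (to (T-∧ {holds k q}) e)))
        ; trans = λ k q v → ⊩-mono (δ A q (w k)) (λ q' g → from T-∧ (v , g)) (consistent k q v) }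

    -- Otherwise the dual marking holds initially, and duality of the transitions lets us follow
    -- a path of the run whose dual is good; their stable colours cannot both be even.
    accepts⇒holds : Accepts A w → T (holds 0 (qinit A))
    accepts⇒holds (G , accepting) = dne λ ¬h → refuted
      (dependent-choice DualAlong Step (root G , init-or-dual ¬h) extend)
      where
      DualAlong : ℕ → State → Set
      DualAlong k q = T (V G k q) × T (holds k (dualState q))
      Step : ℕ → State → State → Set
      Step k q q' = T (E G k q q') × T (good k (dualState q) (dualState q'))
      extend : ∀ k q → DualAlong k q → ∃[ q' ] (Step k q q' × DualAlong (suc k) q')
      extend k q (v , h) with δ-dual k q (E G k q) (good k (dualState q)) (trans G k q v)
        (consistent k (dualState q) h)
      ... | q' , e , g = q' , (e , g) , proj₂ (edges G k q q' e) , proj₁ (toWitness g)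
      refuted : ∃[ π ] (π 0 ≡ qinit A × (∀ k → Step k (π k) (π (suc k)))) → ⊥
      refuted (π , start , steps)
        with good-path-stabilises (dualState ∘ π) (proj₂ ∘ steps) | accepting π (start , proj₁ ∘ steps)
      ... | K , even , const | c , even-c , recurring , _ with recurring K
      ... | k , k≥K , Ωπk≡c = Ω-dual (π k) (subst Even (sym (const k k≥K)) even) (subst Even (sym Ωπk≡c) even-c)

    accepts⇔holds : Accepts A w ⇔ T (holds 0 (qinit A))
    accepts⇔holds = mk⇔ accepts⇒holds holds⇒accepts

-- Unfolding guards

_≈_ : Trace n → Trace n → Set
w ≈ w' = ∀ k → w k ≡ w' k

≈-sym : {w w' : Trace n} → w ≈ w' → w' ≈ w
≈-sym e = sym ∘ e

suffix-resp-≈ : {w w' : Trace n} (j : ℕ) → w ≈ w' → suffix j w ≈ suffix j w'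
suffix-resp-≈ j e k = e (j + k)

suffix-suffix : (w : Trace n) (a m : ℕ) → suffix a (suffix m w) ≈ suffix (m + a) w
suffix-suffix w a m k = cong w (sym (+-assoc m a k))

mutual
  Sem-resp-≈ : ∀ {i} {w w' : Trace n} (φ : Formula n) → w ≈ w' → Sem i w φ → Sem i w' φ
  Sem-resp-≈ (atom p) e s = subst (λ a → T (lookup a p)) (e 0) s
  Sem-resp-≈ (neg φ) e s = λ all → s (λ k → Sem-resp-≈ φ (≈-sym e) (all k))
  Sem-resp-≈ (conj φ ψ) e (s , s') = Sem-resp-≈ φ e s , Sem-resp-≈ ψ e s'
  Sem-resp-≈ (disj φ ψ) e (inj₁ s) = inj₁ (Sem-resp-≈ φ e s)
  Sem-resp-≈ (disj φ ψ) e (inj₂ s) = inj₂ (Sem-resp-≈ ψ e s)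
  Sem-resp-≈ (impl φ ψ) e (inj₁ f) = inj₁ (λ k s → Sem-resp-≈ ψ e (f k (Sem-resp-≈ φ (≈-sym e) s)))
  Sem-resp-≈ (impl φ ψ) e (inj₂ s) = inj₂ (Sem-resp-≈ ψ e s)
  Sem-resp-≈ (dia r φ) e (j , m , s) = j , Match-resp-≈ r e m , Sem-resp-≈ φ (suffix-resp-≈ j e) s
  Sem-resp-≈ (box r φ) e (k , k≤i , b) = k , k≤i , BoxBit-resp-≈ k r φ e b

  Infinite-Match-resp-≈ : ∀ {i} {w w' : Trace n} (r : Guard n) → w ≈ w' →
    Infinite (Match i w r) → Infinite (Match i w' r)
  Infinite-Match-resp-≈ r e inf N with inf N
  ... | j , j≥N , m = j , j≥N , Match-resp-≈ r e m

  BoxBit-resp-≈ : ∀ {w w' : Trace n} k (r : Guard n) (φ : Formula n) → w ≈ w' → BoxBit k w r φ → BoxBit k w' r φ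
  BoxBit-resp-≈ fz r φ e b = λ j m → Sem-resp-≈ φ (suffix-resp-≈ j e) (b j (Match-resp-≈ r (≈-sym e) m))
  BoxBit-resp-≈ (fs fz) r φ e (inj₁ (inf , j' , f)) =
    inj₁ (Infinite-Match-resp-≈ r e inf , j' ,
      λ j j≥j' m → Sem-resp-≈ φ (suffix-resp-≈ j e) (f j j≥j' (Match-resp-≈ r (≈-sym e) m)))
  BoxBit-resp-≈ (fs fz) r φ e (inj₂ (¬inf , f)) =
    inj₂ (¬inf ∘ Infinite-Match-resp-≈ r (≈-sym e) ,
      λ j m → Sem-resp-≈ φ (suffix-resp-≈ j e) (f j (Match-resp-≈ r (≈-sym e) m)))
  BoxBit-resp-≈ (fs (fs fz)) r φ e (inj₁ (inf , f)) =
    inj₁ (Infinite-Match-resp-≈ r e inf , λ j' → let (j , j≥j' , m , s) = f j' in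
      j , j≥j' , Match-resp-≈ r e m , Sem-resp-≈ φ (suffix-resp-≈ j e) s)
  BoxBit-resp-≈ (fs (fs fz)) r φ e (inj₂ (¬inf , inj₁ (j , m , s))) =
    inj₂ (¬inf ∘ Infinite-Match-resp-≈ r (≈-sym e) , inj₁
      (j , Match-resp-≈ r e m , Sem-resp-≈ φ (suffix-resp-≈ j e) s))
  BoxBit-resp-≈ (fs (fs fz)) r φ e (inj₂ (¬inf , inj₂ none)) =
    inj₂ (¬inf ∘ Infinite-Match-resp-≈ r (≈-sym e) , inj₂ λ (j , m) → none (j , Match-resp-≈ r (≈-sym e) m))
  BoxBit-resp-≈ (fs (fs (fs fz))) r φ e (inj₁ (j , m , s)) =
    inj₁ (j , Match-resp-≈ r e m , Sem-resp-≈ φ (suffix-resp-≈ j e) s)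
  BoxBit-resp-≈ (fs (fs (fs fz))) r φ e (inj₂ none) = inj₂ λ (j , m) → none (j , Match-resp-≈ r (≈-sym e) m)

  Match-resp-≈ : ∀ {i} {w w' : Trace n} {j} (r : Guard n) → w ≈ w' → Match i w r j → Match i w' r j
  Match-resp-≈ (gprop φ) e (j≡1 , t) = j≡1 , subst (λ a → T (evalP φ a)) (e 0) t
  Match-resp-≈ (gtest ψ) e (j≡0 , s) = j≡0 , Sem-resp-≈ ψ e s
  Match-resp-≈ (gplus r s) e (inj₁ m) = inj₁ (Match-resp-≈ r e m)
  Match-resp-≈ (gplus r s) e (inj₂ m) = inj₂ (Match-resp-≈ s e m)
  Match-resp-≈ (gseq r s) e (j₀ , j₁ , m₀ , m₁ , eq) =
    j₀ , j₁ , Match-resp-≈ r e m₀ , Match-resp-≈ s (suffix-resp-≈ j₀ e) m₁ , eq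
  Match-resp-≈ (gstar r) e (ℓ , js , ms , eq) =
    ℓ , js , (λ k → Match-resp-≈ r (suffix-resp-≈ (psum js k) e) (ms k)) , eq

data Leaf {n} : Guard n → Set where
  letter : ∀ {φ} → Leaf (gprop φ)
  plusˡ : ∀ {r s} → Leaf r → Leaf (gplus r s)
  plusʳ : ∀ {r s} → Leaf s → Leaf (gplus r s)
  seqˡ : ∀ {r s} → Leaf r → Leaf (gseq r s)
  seqʳ : ∀ {r s} → Leaf s → Leaf (gseq r s)
  star : ∀ {r} → Leaf r → Leaf (gstar r)

data TestPos {n} : Guard n → Set where
  test : ∀ {ψ} → TestPos (gtest ψ)
  plusˡ : ∀ {r s} → TestPos r → TestPos (gplus r s)
  plusʳ : ∀ {r s} → TestPos s → TestPos (gplus r s)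
  seqˡ : ∀ {r s} → TestPos r → TestPos (gseq r s)
  seqʳ : ∀ {r s} → TestPos s → TestPos (gseq r s)
  star : ∀ {r} → TestPos r → TestPos (gstar r)

testFormula : {r : Guard n} → TestPos r → Formula n
testFormula (test {ψ = ψ}) = ψ
testFormula (plusˡ t) = testFormula t
testFormula (plusʳ t) = testFormula t
testFormula (seqˡ t) = testFormula t
testFormula (seqʳ t) = testFormula t
testFormula (star t) = testFormula t

-- Branchings describe how the rest of a guard can continue from the current letter: each branch is
-- guarded by tests X evaluated at the current position and ends either at a leaf L (a letter read
-- now, continuing at the next position) or at the end of the guard ([done], nothing read).
data Branching (X L : Set) : Set where
  fail done : Branching X L
  leaf : L → Branching X L
  _∪_ : Branching X L → Branching X L → Branching X L
  _▷_ : PosBool X → Branching X L → Branching X L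

⟦_⟧ᴮ : Branching X L → (X → Set) → (L → Set) → Set → Set
⟦ fail ⟧ᴮ τ λv ε = ⊥
⟦ done ⟧ᴮ τ λv ε = ε
⟦ leaf l ⟧ᴮ τ λv ε = λv l
⟦ b ∪ b' ⟧ᴮ τ λv ε = ⟦ b ⟧ᴮ τ λv ε ⊎ ⟦ b' ⟧ᴮ τ λv ε
⟦ t ▷ b ⟧ᴮ τ λv ε = ⟦ t ⟧ τ × ⟦ b ⟧ᴮ τ λv ε

⟦⟧ᴮ-mono : ∀ (b : Branching X L) {τ τ' : X → Set} {λv λv' : L → Set} {ε ε' : Set} →
  (∀ x → τ x → τ' x) → (∀ l → λv l → λv' l) → (ε → ε') → ⟦ b ⟧ᴮ τ λv ε → ⟦ b ⟧ᴮ τ' λv' ε'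
⟦⟧ᴮ-mono done hτ hλ hε p = hε p
⟦⟧ᴮ-mono (leaf l) hτ hλ hε p = hλ l p
⟦⟧ᴮ-mono (b ∪ b') hτ hλ hε (inj₁ p) = inj₁ (⟦⟧ᴮ-mono b hτ hλ hε p)
⟦⟧ᴮ-mono (b ∪ b') hτ hλ hε (inj₂ p) = inj₂ (⟦⟧ᴮ-mono b' hτ hλ hε p)
⟦⟧ᴮ-mono (t ▷ b) hτ hλ hε (p , p') = ⟦⟧-mono t hτ p , ⟦⟧ᴮ-mono b hτ hλ hε p'

-- In the unfoldings below, eX and eL embed the tests and leaves of s into those of an enclosing guard.
nullable : (s : Guard n) → (TestPos s → X) → PosBool X
nullable (gprop φ) eX = bfalse
nullable (gtest ψ) eX = bstate (eX test)
nullable (gplus r s) eX = bor (nullable r (eX ∘ plusˡ)) (nullable s (eX ∘ plusʳ))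
nullable (gseq r s) eX = band (nullable r (eX ∘ seqˡ)) (nullable s (eX ∘ seqʳ))
nullable (gstar r) eX = btrue

firstStep : (s : Guard n) → Letter n → (TestPos s → X) → (Leaf s → L) → Branching X L
firstStep (gprop φ) a eX eL = if evalP φ a then leaf (eL letter) else fail
firstStep (gtest ψ) a eX eL = fail
firstStep (gplus r s) a eX eL =
  firstStep r a (eX ∘ plusˡ) (eL ∘ plusˡ) ∪ firstStep s a (eX ∘ plusʳ) (eL ∘ plusʳ)
firstStep (gseq r s) a eX eL =
  firstStep r a (eX ∘ seqˡ) (eL ∘ seqˡ) ∪ (nullable r (eX ∘ seqˡ) ▷ firstStep s a (eX ∘ seqʳ) (eL ∘ seqʳ))
firstStep (gstar r) a eX eL = firstStep r a (eX ∘ star) (eL ∘ star)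

unfold : (s : Guard n) → Letter n → (TestPos s → X) → (Leaf s → L) → Branching X L → Branching X L
unfold s a eX eL k = (nullable s eX ▷ k) ∪ firstStep s a eX eL

resume : (s : Guard n) → Leaf s → Letter n → (TestPos s → X) → (Leaf s → L) → Branching X L → Branching X L
resume (gprop φ) letter a eX eL k = k
resume (gplus r s) (plusˡ l) a eX eL k = resume r l a (eX ∘ plusˡ) (eL ∘ plusˡ) k
resume (gplus r s) (plusʳ l) a eX eL k = resume s l a (eX ∘ plusʳ) (eL ∘ plusʳ) k
resume (gseq r s) (seqˡ l) a eX eL k =
  resume r l a (eX ∘ seqˡ) (eL ∘ seqˡ) (unfold s a (eX ∘ seqʳ) (eL ∘ seqʳ) k)
resume (gseq r s) (seqʳ l) a eX eL k = resume s l a (eX ∘ seqʳ) (eL ∘ seqʳ) k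
resume (gstar r) (star l) a eX eL k =
  resume r l a (eX ∘ star) (eL ∘ star) (k ∪ firstStep r a (eX ∘ star) (eL ∘ star))

star-empty : ∀ {i} {w : Trace n} (r : Guard n) → Match i w (gstar r) 0
star-empty r = 0 , (λ ()) , (λ ()) , refl

star-unroll⇐ : ∀ {i} {w : Trace n} (r : Guard n) {t₁ t₂} → Match i w r (suc t₁) →
  Match i (suffix (suc t₁) w) (gstar r) t₂ → Match i w (gstar r) (suc t₁ + t₂)
star-unroll⇐ {i = i} {w} r {t₁} first (ℓ , js , ms , refl) = suc ℓ , js' , ms' , refl
  where
  js' : Fin (suc ℓ) → ℕ
  js' fz = suc t₁
  js' (fs k) = js k
  ms' : ∀ k → Match i (suffix (psum js' k) w) r (js' k)
  ms' fz = first
  ms' (fs k) = Match-resp-≈ r (suffix-suffix w (psum js k) (suc t₁)) (ms k)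

-- Leading iterations that match the empty word are dropped.
star-unroll⇒ : ∀ {i} {w : Trace n} (r : Guard n) {t} → Match i w (gstar r) t →
  t ≡ 0 ⊎ ∃[ t₁ ] ∃[ t₂ ] (Match i w r (suc t₁) × Match i (suffix (suc t₁) w) (gstar r) t₂ × t ≡ suc t₁ + t₂)
star-unroll⇒ {i = i} {w} r (ℓ , js , ms , refl) = iterations ℓ js ms
  where
  iterations : ∀ ℓ (js : Fin ℓ → ℕ) → (∀ k → Match i (suffix (psum js k) w) r (js k)) →
    total js ≡ 0 ⊎ ∃[ t₁ ] ∃[ t₂ ]
      (Match i w r (suc t₁) × Match i (suffix (suc t₁) w) (gstar r) t₂ × total js ≡ suc t₁ + t₂)
  iterations zero js ms = inj₁ refl
  iterations (suc ℓ) js ms with js fz | ms fz | ms ∘ fs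
  ... | zero | _ | rest = iterations ℓ (js ∘ fs) rest
  ... | suc t₁ | first | rest = inj₂ (t₁ , total (js ∘ fs) , first , (ℓ , js ∘ fs , rest′ , refl) , refl)
    where
    rest′ : ∀ k → Match i (suffix (psum (js ∘ fs) k) (suffix (suc t₁) w)) r (js (fs k))
    rest′ k = Match-resp-≈ r (≈-sym (suffix-suffix w (psum (js ∘ fs) k) (suc t₁))) (rest k)

if-then-fail : ∀ b {B : Branching X L} {τ λv ε} → ⟦ if b then B else fail ⟧ᴮ τ λv ε ⇔ (T b × ⟦ B ⟧ᴮ τ λv ε)
if-then-fail true = mk⇔ (tt ,_) proj₂
if-then-fail false = mk⇔ (λ ()) (λ ())

module Matching {n : ℕ} (w : Trace n) (i : Fin 4) where

  SemAt : ℕ → Formula n → Set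
  SemAt m ψ = Sem i (suffix m w) ψ

  MatchAt : ℕ → Guard n → ℕ → Set
  MatchAt m r t = Match i (suffix m w) r t

  Tests : {s : Guard n} → ℕ → TestPos s → Set
  Tests m t = SemAt m (testFormula t)

  Reaches : Guard n → ℕ → (ℕ → Set) → Set
  Reaches r m P = ∃[ t ] (MatchAt m r t × P (m + t))

  Reaches⁺ : Guard n → ℕ → (ℕ → Set) → Set
  Reaches⁺ r m P = ∃[ t ] (MatchAt m r (suc t) × P (m + suc t))

  -- Having read leaf l of s just before position m, the rest of s matches from m to a position in P.
  Resume : (s : Guard n) → Leaf s → (ℕ → Set) → ℕ → Set
  Resume (gprop φ) letter P m = P m
  Resume (gplus r s) (plusˡ l) P m = Resume r l P m
  Resume (gplus r s) (plusʳ l) P m = Resume s l P m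
  Resume (gseq r s) (seqˡ l) P m = Resume r l (λ p → Reaches s p P) m
  Resume (gseq r s) (seqʳ l) P m = Resume s l P m
  Resume (gstar r) (star l) P m = Resume r l (λ p → Reaches (gstar r) p P) m

  letter-at : ∀ m → suffix m w 0 ≡ w m
  letter-at m = cong w (+-identityʳ m)

  MatchAt-shift : ∀ r a m {t} → Match i (suffix a (suffix m w)) r t ⇔ MatchAt (m + a) r t
  MatchAt-shift r a m =
    mk⇔ (Match-resp-≈ r (suffix-suffix w a m)) (Match-resp-≈ r (≈-sym (suffix-suffix w a m)))

  Reaches-mono : ∀ s m {P P' : ℕ → Set} → (∀ p → P p → P' p) → Reaches s m P → Reaches s m P'
  Reaches-mono s m h (t , x , p) = t , x , h _ p

  Reaches-split : ∀ s m P → Reaches s m P ⇔ ((MatchAt m s 0 × P m) ⊎ Reaches⁺ s m P)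
  Reaches-split s m P = mk⇔ forth back
    where
    forth : Reaches s m P → (MatchAt m s 0 × P m) ⊎ Reaches⁺ s m P
    forth (zero , x , p) = inj₁ (x , subst P (+-identityʳ m) p)
    forth (suc t , x , p) = inj₂ (t , x , p)
    back : (MatchAt m s 0 × P m) ⊎ Reaches⁺ s m P → Reaches s m P
    back (inj₁ (x , p)) = 0 , x , subst P (sym (+-identityʳ m)) p
    back (inj₂ (t , x , p)) = suc t , x , p

  Reaches-star-split : ∀ r m P → Reaches (gstar r) m P ⇔ (P m ⊎ Reaches⁺ (gstar r) m P)
  Reaches-star-split r m P = ⇔-trans (Reaches-split (gstar r) m P)
    (mk⇔ proj₂ (star-empty {w = suffix m w} r ,_) ⊎-⇔ ⇔-refl)

  Reaches⁺-star : ∀ r m P → Reaches⁺ (gstar r) m P ⇔ Reaches⁺ r m (λ p → Reaches (gstar r) p P)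
  Reaches⁺-star r m P = mk⇔ forth back
    where
    forth : Reaches⁺ (gstar r) m P → Reaches⁺ r m (λ p → Reaches (gstar r) p P)
    forth (t , x , p) with star-unroll⇒ r x
    ... | inj₂ (t₁ , t₂ , first , rest , e) = t₁ , first , t₂ , to (MatchAt-shift (gstar r) (suc t₁) m) rest ,
      subst P (≡.trans (cong (m +_) e) (sym (+-assoc m (suc t₁) t₂))) p
    back : Reaches⁺ r m (λ p → Reaches (gstar r) p P) → Reaches⁺ (gstar r) m P
    back (t₁ , first , t₂ , rest , p) =
      t₁ + t₂ , star-unroll⇐ r first (from (MatchAt-shift (gstar r) (suc t₁) m) rest) ,
      subst P (+-assoc m (suc t₁) t₂) p

  nullable-correct : ∀ s m (eX : TestPos s → X) (τ : X → Set) → (∀ t → τ (eX t) ⇔ Tests m t) →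
    MatchAt m s 0 ⇔ ⟦ nullable s eX ⟧ τ
  nullable-correct (gprop φ) m eX τ hτ = mk⇔ (λ { (() , _) }) λ ()
  nullable-correct (gtest ψ) m eX τ hτ = mk⇔ (λ (_ , t) → from (hτ test) t) (λ t → refl , to (hτ test) t)
  nullable-correct (gplus r s) m eX τ hτ =
    nullable-correct r m (eX ∘ plusˡ) τ (hτ ∘ plusˡ) ⊎-⇔ nullable-correct s m (eX ∘ plusʳ) τ (hτ ∘ plusʳ)
  nullable-correct (gseq r s) m eX τ hτ =
    ⇔-trans (mk⇔ split join)
      (nullable-correct r m (eX ∘ seqˡ) τ (hτ ∘ seqˡ) ×-⇔ nullable-correct s m (eX ∘ seqʳ) τ (hτ ∘ seqʳ))
    where
    split : MatchAt m (gseq r s) 0 → MatchAt m r 0 × MatchAt m s 0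
    split (zero , zero , x , y , refl) = x , y
    split (zero , suc _ , _ , _ , ())
    split (suc _ , _ , _ , _ , ())
    join : MatchAt m r 0 × MatchAt m s 0 → MatchAt m (gseq r s) 0
    join (x , y) = 0 , 0 , x , y , refl
  nullable-correct (gstar r) m eX τ hτ = mk⇔ (λ _ → tt) (λ _ → star-empty {w = suffix m w} r)

  firstStep-correct : ∀ s m P (eX : TestPos s → X) (eL : Leaf s → L) τ λv ε →
    (∀ t → τ (eX t) ⇔ Tests m t) → (∀ l → λv (eL l) ⇔ Resume s l P (suc m)) →
    Reaches⁺ s m P ⇔ ⟦ firstStep s (w m) eX eL ⟧ᴮ τ λv ε
  firstStep-correct (gprop φ) m P eX eL τ λv ε hτ hλ = ⇔-trans (mk⇔ forth back)
    (⇔-sym (if-then-fail (evalP φ (w m))))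
    where
    forth : Reaches⁺ (gprop φ) m P → T (evalP φ (w m)) × λv (eL letter)
    forth (zero , (refl , holds) , p) =
      subst (T ∘ evalP φ) (letter-at m) holds , from (hλ letter) (subst P (+-comm m 1) p)
    forth (suc _ , (() , _) , _)
    back : T (evalP φ (w m)) × λv (eL letter) → Reaches⁺ (gprop φ) m P
    back (holds , l) =
      0 , (refl , subst (T ∘ evalP φ) (sym (letter-at m)) holds) , subst P (+-comm 1 m) (to (hλ letter) l)
  firstStep-correct (gtest ψ) m P eX eL τ λv ε hτ hλ = mk⇔ (λ { (_ , (() , _) , _) }) λ ()
  firstStep-correct (gplus r s) m P eX eL τ λv ε hτ hλ = ⇔-trans (mk⇔ split join)
    (firstStep-correct r m P (eX ∘ plusˡ) (eL ∘ plusˡ) τ λv ε (hτ ∘ plusˡ) (hλ ∘ plusˡ) ⊎-⇔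
     firstStep-correct s m P (eX ∘ plusʳ) (eL ∘ plusʳ) τ λv ε (hτ ∘ plusʳ) (hλ ∘ plusʳ))
    where
    split : Reaches⁺ (gplus r s) m P → Reaches⁺ r m P ⊎ Reaches⁺ s m P
    split (t , inj₁ x , p) = inj₁ (t , x , p)
    split (t , inj₂ x , p) = inj₂ (t , x , p)
    join : Reaches⁺ r m P ⊎ Reaches⁺ s m P → Reaches⁺ (gplus r s) m P
    join (inj₁ (t , x , p)) = t , inj₁ x , p
    join (inj₂ (t , x , p)) = t , inj₂ x , p
  firstStep-correct (gseq r s) m P eX eL τ λv ε hτ hλ = ⇔-trans (mk⇔ split join)
    (firstStep-correct r m (λ p → Reaches s p P) (eX ∘ seqˡ) (eL ∘ seqˡ) τ λv ε (hτ ∘ seqˡ) (hλ ∘ seqˡ) ⊎-⇔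
     (nullable-correct r m (eX ∘ seqˡ) τ (hτ ∘ seqˡ) ×-⇔
      firstStep-correct s m P (eX ∘ seqʳ) (eL ∘ seqʳ) τ λv ε (hτ ∘ seqʳ) (hλ ∘ seqʳ)))
    where
    split : Reaches⁺ (gseq r s) m P → Reaches⁺ r m (λ p → Reaches s p P) ⊎ (MatchAt m r 0 × Reaches⁺ s m P)
    split (t , (zero , t' , x , y , e) , p) = inj₂ (x , t , subst (MatchAt m s) (sym e) y , p)
    split (t , (suc t₀ , t' , x , y , e) , p) = inj₁ (t₀ , x , t' , to (MatchAt-shift s (suc t₀) m) y ,
      subst P (≡.trans (cong (m +_) e) (sym (+-assoc m (suc t₀) t'))) p)
    join : Reaches⁺ r m (λ p → Reaches s p P) ⊎ (MatchAt m r 0 × Reaches⁺ s m P) → Reaches⁺ (gseq r s) m P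
    join (inj₁ (t₀ , x , t' , y , p)) =
      t₀ + t' , (suc t₀ , t' , x , from (MatchAt-shift s (suc t₀) m) y , refl) ,
      subst P (+-assoc m (suc t₀) t') p
    join (inj₂ (x , t , y , p)) = t , (0 , suc t , x , y , refl) , p
  firstStep-correct (gstar r) m P eX eL τ λv ε hτ hλ = ⇔-trans (Reaches⁺-star r m P)
    (firstStep-correct r m (λ p → Reaches (gstar r) p P) (eX ∘ star) (eL ∘ star) τ λv ε (hτ ∘ star) (hλ ∘ star))

  unfold-correct : ∀ s m P (eX : TestPos s → X) (eL : Leaf s → L) k τ λv ε →
    (∀ t → τ (eX t) ⇔ Tests m t) → (∀ l → λv (eL l) ⇔ Resume s l P (suc m)) → (⟦ k ⟧ᴮ τ λv ε ⇔ P m) →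
    Reaches s m P ⇔ ⟦ unfold s (w m) eX eL k ⟧ᴮ τ λv ε
  unfold-correct s m P eX eL k τ λv ε hτ hλ hk = ⇔-trans (Reaches-split s m P)
    ((nullable-correct s m eX τ hτ ×-⇔ ⇔-sym hk) ⊎-⇔ firstStep-correct s m P eX eL τ λv ε hτ hλ)

  resume-correct : ∀ s (l : Leaf s) m P (eX : TestPos s → X) (eL : Leaf s → L) k τ λv ε →
    (∀ t → τ (eX t) ⇔ Tests m t) → (∀ l → λv (eL l) ⇔ Resume s l P (suc m)) → (⟦ k ⟧ᴮ τ λv ε ⇔ P m) →
    Resume s l P m ⇔ ⟦ resume s l (w m) eX eL k ⟧ᴮ τ λv ε
  resume-correct (gprop φ) letter m P eX eL k τ λv ε hτ hλ hk = ⇔-sym hk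
  resume-correct (gplus r s) (plusˡ l) m P eX eL k τ λv ε hτ hλ hk =
    resume-correct r l m P (eX ∘ plusˡ) (eL ∘ plusˡ) k τ λv ε (hτ ∘ plusˡ) (hλ ∘ plusˡ) hk
  resume-correct (gplus r s) (plusʳ l) m P eX eL k τ λv ε hτ hλ hk =
    resume-correct s l m P (eX ∘ plusʳ) (eL ∘ plusʳ) k τ λv ε (hτ ∘ plusʳ) (hλ ∘ plusʳ) hk
  resume-correct (gseq r s) (seqˡ l) m P eX eL k τ λv ε hτ hλ hk =
    resume-correct r l m (λ p → Reaches s p P) (eX ∘ seqˡ) (eL ∘ seqˡ) _ τ λv ε (hτ ∘ seqˡ) (hλ ∘ seqˡ)
      (⇔-sym (unfold-correct s m P (eX ∘ seqʳ) (eL ∘ seqʳ) k τ λv ε (hτ ∘ seqʳ) (hλ ∘ seqʳ) hk))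
  resume-correct (gseq r s) (seqʳ l) m P eX eL k τ λv ε hτ hλ hk =
    resume-correct s l m P (eX ∘ seqʳ) (eL ∘ seqʳ) k τ λv ε (hτ ∘ seqʳ) (hλ ∘ seqʳ) hk
  resume-correct (gstar r) (star l) m P eX eL k τ λv ε hτ hλ hk =
    resume-correct r l m (λ p → Reaches (gstar r) p P) (eX ∘ star) (eL ∘ star) _ τ λv ε (hτ ∘ star) (hλ ∘ star)
      (⇔-trans (hk ⊎-⇔ ⇔-sym
        (⇔-trans (Reaches⁺-star r m P)
        (firstStep-correct r m _ (eX ∘ star) (eL ∘ star) τ λv ε (hτ ∘ star) (hλ ∘ star))))
        (⇔-sym (Reaches-star-split r m P)))

  Resume-mono : ∀ s (l : Leaf s) m {P P' : ℕ → Set} → (∀ p → P p → P' p) → Resume s l P m → Resume s l P' m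
  Resume-mono (gprop φ) letter m h x = h m x
  Resume-mono (gplus r s) (plusˡ l) m h x = Resume-mono r l m h x
  Resume-mono (gplus r s) (plusʳ l) m h x = Resume-mono s l m h x
  Resume-mono (gseq r s) (seqˡ l) m h x = Resume-mono r l m (λ p → Reaches-mono s p h) x
  Resume-mono (gseq r s) (seqʳ l) m h x = Resume-mono s l m h x
  Resume-mono (gstar r) (star l) m h x = Resume-mono r l m (λ p → Reaches-mono (gstar r) p h) x

  Resume-∃ : ∀ s (l : Leaf s) m (F : ℕ → ℕ → Set) →
    Resume s l (λ p → ∃[ j ] F j p) m → ∃[ j ] Resume s l (F j) m
  Resume-∃ (gprop φ) letter m F x = x
  Resume-∃ (gplus r s) (plusˡ l) m F x = Resume-∃ r l m F x
  Resume-∃ (gplus r s) (plusʳ l) m F x = Resume-∃ s l m F x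
  Resume-∃ (gseq r s) (seqˡ l) m F x =
    Resume-∃ r l m (λ j p → Reaches s p (F j)) (Resume-mono r l m (λ { p (t , y , j , c) → j , t , y , c }) x)
  Resume-∃ (gseq r s) (seqʳ l) m F x = Resume-∃ s l m F x
  Resume-∃ (gstar r) (star l) m F x =
    Resume-∃ r l m (λ j p → Reaches (gstar r) p (F j))
      (Resume-mono r l m (λ { p (t , y , j , c) → j , t , y , c }) x)

  Resume-bounded : ∀ s (l : Leaf s) m j {P : ℕ → Set} → (∀ p → P p → p ≤ j) → Resume s l P m → m ≤ j
  Resume-bounded (gprop φ) letter m j h x = h m x
  Resume-bounded (gplus r s) (plusˡ l) m j h x = Resume-bounded r l m j h x
  Resume-bounded (gplus r s) (plusʳ l) m j h x = Resume-bounded s l m j h x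
  Resume-bounded (gseq r s) (seqˡ l) m j h x = Resume-bounded r l m j
    (λ { p (t , _ , c) → ≤-trans (m≤m+n p t) (h (p + t) c) }) x
  Resume-bounded (gseq r s) (seqʳ l) m j h x = Resume-bounded s l m j h x
  Resume-bounded (gstar r) (star l) m j h x = Resume-bounded r l m j
    (λ { p (t , _ , c) → ≤-trans (m≤m+n p t) (h (p + t) c) }) x

module _ (em : ExcludedMiddle 0ℓ) where
  open Classical em

  Infinite-⟦⟧ᴮ⇒ : ∀ (b : Branching X L) (τ : X → Set) (λs : ℕ → L → Set) (εs : ℕ → Set) →
    Infinite (λ j → ⟦ b ⟧ᴮ τ (λs j) (εs j)) → ⟦ b ⟧ᴮ τ (λ l → Infinite (λ j → λs j l)) (Infinite εs)
  Infinite-⟦⟧ᴮ⇒ fail τ λs εs inf with inf 0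
  ... | _ , _ , ()
  Infinite-⟦⟧ᴮ⇒ done τ λs εs inf = inf
  Infinite-⟦⟧ᴮ⇒ (leaf l) τ λs εs inf = inf
  Infinite-⟦⟧ᴮ⇒ (b ∪ b') τ λs εs inf with Infinite-⊎ inf
  ... | inj₁ infˡ = inj₁ (Infinite-⟦⟧ᴮ⇒ b τ λs εs infˡ)
  ... | inj₂ infʳ = inj₂ (Infinite-⟦⟧ᴮ⇒ b' τ λs εs infʳ)
  Infinite-⟦⟧ᴮ⇒ (t ▷ b) τ λs εs inf =
    proj₁ (proj₂ (proj₂ (inf 0))) , Infinite-⟦⟧ᴮ⇒ b τ λs εs λ N → let (j , j≥N , _ , p) = inf N in j , j≥N , p

Infinite-⟦⟧ᴮ⇐ : ∀ (b : Branching X L) (τ : X → Set) (λs : ℕ → L → Set) (εs : ℕ → Set) →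
  ⟦ b ⟧ᴮ τ (λ l → Infinite (λ j → λs j l)) (Infinite εs) → Infinite (λ j → ⟦ b ⟧ᴮ τ (λs j) (εs j))
Infinite-⟦⟧ᴮ⇐ done τ λs εs p = p
Infinite-⟦⟧ᴮ⇐ (leaf l) τ λs εs p = p
Infinite-⟦⟧ᴮ⇐ (b ∪ b') τ λs εs (inj₁ p) N = let (j , j≥N , q) = Infinite-⟦⟧ᴮ⇐ b τ λs εs p N in j , j≥N , inj₁ q
Infinite-⟦⟧ᴮ⇐ (b ∪ b') τ λs εs (inj₂ p) N = let (j , j≥N , q) = Infinite-⟦⟧ᴮ⇐ b' τ λs εs p N in j , j≥N , inj₂ q
Infinite-⟦⟧ᴮ⇐ (t ▷ b) τ λs εs (t-holds , p) N =
  let (j , j≥N , q) = Infinite-⟦⟧ᴮ⇐ b τ λs εs p N in j , j≥N , t-holds , q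

⟦⟧ᴮ-leaf : ∀ (b : Branching X L) (τ : X → Set) (λv : L → Set) → ⟦ b ⟧ᴮ τ λv ⊥ →
  ∃[ l ] (λv l × (∀ (λv' : L → Set) ε' → λv' l → ⟦ b ⟧ᴮ τ λv' ε'))
⟦⟧ᴮ-leaf (leaf l) τ λv p = l , p , λ _ _ q → q
⟦⟧ᴮ-leaf (b ∪ b') τ λv (inj₁ p) =
  let (l , q , rebuild) = ⟦⟧ᴮ-leaf b τ λv p in l , q , λ λv' ε' q' → inj₁ (rebuild λv' ε' q')
⟦⟧ᴮ-leaf (b ∪ b') τ λv (inj₂ p) =
  let (l , q , rebuild) = ⟦⟧ᴮ-leaf b' τ λv p in l , q , λ λv' ε' q' → inj₂ (rebuild λv' ε' q')
⟦⟧ᴮ-leaf (t ▷ b) τ λv (t-holds , p) =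
  let (l , q , rebuild) = ⟦⟧ᴮ-leaf b τ λv p in l , q , λ λv' ε' q' → t-holds , rebuild λv' ε' q'

instantiate : Branching X L → (X → PosBool Q) → (L → PosBool Q) → PosBool Q → PosBool Q
instantiate fail fX fL e = bfalse
instantiate done fX fL e = e
instantiate (leaf l) fX fL e = fL l
instantiate (b ∪ b') fX fL e = bor (instantiate b fX fL e) (instantiate b' fX fL e)
instantiate (t ▷ b) fX fL e = band (bind t fX) (instantiate b fX fL e)

⊩-instantiate : ∀ (S : Q → Bool) (b : Branching X L) fX fL e →
  S ⊩ instantiate b fX fL e ⇔ ⟦ b ⟧ᴮ (λ x → S ⊩ fX x) (λ l → S ⊩ fL l) (S ⊩ e)
⊩-instantiate S fail fX fL e = ⇔-refl
⊩-instantiate S done fX fL e = ⇔-refl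
⊩-instantiate S (leaf l) fX fL e = ⇔-refl
⊩-instantiate S (b ∪ b') fX fL e = ⊩-instantiate S b fX fL e ⊎-⇔ ⊩-instantiate S b' fX fL e
⊩-instantiate S (t ▷ b) fX fL e = ⊩-bind S t fX ×-⇔ ⊩-instantiate S b fX fL e

Every-instantiate : ∀ {P : Q → Set} (b : Branching X L) fX fL e →
  (∀ x → Every P (fX x)) → (∀ l → Every P (fL l)) → Every P e → Every P (instantiate b fX fL e)
Every-instantiate fail fX fL e hX hL he = tt
Every-instantiate done fX fL e hX hL he = he
Every-instantiate (leaf l) fX fL e hX hL he = hL l
Every-instantiate (b ∪ b') fX fL e hX hL he =
  Every-instantiate b fX fL e hX hL he , Every-instantiate b' fX fL e hX hL he
Every-instantiate (t ▷ b) fX fL e hX hL he = Every-bind t fX hX , Every-instantiate b fX fL e hX hL he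

-- The automaton

-- Positions of the letters of guards in modal subformulas (including those inside tests); these
-- carry the automaton states besides the initial one.
mutual
  data Pos {n} : Formula n → Set where
    inNeg : ∀ {a} → Pos a → Pos (neg a)
    inConjˡ : ∀ {a b} → Pos a → Pos (conj a b)
    inConjʳ : ∀ {a b} → Pos b → Pos (conj a b)
    inDisjˡ : ∀ {a b} → Pos a → Pos (disj a b)
    inDisjʳ : ∀ {a b} → Pos b → Pos (disj a b)
    inImplˡ : ∀ {a b} → Pos a → Pos (impl a b)
    inImplʳ : ∀ {a b} → Pos b → Pos (impl a b)
    diaLeaf : ∀ {r a} → Leaf r → Pos (dia r a)
    diaGuard : ∀ {r a} → GPos r → Pos (dia r a)
    diaBody : ∀ {r a} → Pos a → Pos (dia r a)
    boxLeaf : ∀ {r a} → Leaf r → Pos (box r a)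
    boxGuard : ∀ {r a} → GPos r → Pos (box r a)
    boxBody : ∀ {r a} → Pos a → Pos (box r a)

  data GPos {n} : Guard n → Set where
    inTest : ∀ {ψ} → Pos ψ → GPos (gtest ψ)
    plusˡ : ∀ {r s} → GPos r → GPos (gplus r s)
    plusʳ : ∀ {r s} → GPos s → GPos (gplus r s)
    seqˡ : ∀ {r s} → GPos r → GPos (gseq r s)
    seqʳ : ∀ {r s} → GPos s → GPos (gseq r s)
    star : ∀ {r} → GPos r → GPos (gstar r)

record Site (n : ℕ) : Set where
  constructor site
  field
    guard : Guard n
    body : Formula n
    letterOf : Leaf guard

mutual
  siteOf : {ψ : Formula n} → Pos ψ → Site n
  siteOf (inNeg p) = siteOf p
  siteOf (inConjˡ p) = siteOf p
  siteOf (inConjʳ p) = siteOf p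
  siteOf (inDisjˡ p) = siteOf p
  siteOf (inDisjʳ p) = siteOf p
  siteOf (inImplˡ p) = siteOf p
  siteOf (inImplʳ p) = siteOf p
  siteOf (diaLeaf {r = r} {a} l) = site r a l
  siteOf (diaGuard g) = siteOfᴳ g
  siteOf (diaBody p) = siteOf p
  siteOf (boxLeaf {r = r} {a} l) = site r a l
  siteOf (boxGuard g) = siteOfᴳ g
  siteOf (boxBody p) = siteOf p

  siteOfᴳ : {r : Guard n} → GPos r → Site n
  siteOfᴳ (inTest p) = siteOf p
  siteOfᴳ (plusˡ g) = siteOfᴳ g
  siteOfᴳ (plusʳ g) = siteOfᴳ g
  siteOfᴳ (seqˡ g) = siteOfᴳ g
  siteOfᴳ (seqʳ g) = siteOfᴳ g
  siteOfᴳ (star g) = siteOfᴳ g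

SitePreserving : {ψ φ : Formula n} → (Pos ψ → Pos φ) → Set
SitePreserving e = ∀ p → siteOf (e p) ≡ siteOf p

SitePreservingᴳ : {r : Guard n} {φ : Formula n} → (GPos r → Pos φ) → Set
SitePreservingᴳ e = ∀ g → siteOf (e g) ≡ siteOfᴳ g

-- Tree sizes, used only for ranks (the size |φ| of the statement is [size]).
mutual
  formulaSize : Formula n → ℕ
  formulaSize (atom p) = 1
  formulaSize (neg a) = suc (formulaSize a)
  formulaSize (conj a b) = suc (formulaSize a + formulaSize b)
  formulaSize (disj a b) = suc (formulaSize a + formulaSize b)
  formulaSize (impl a b) = suc (formulaSize a + formulaSize b)
  formulaSize (dia r a) = suc (guardSize r + formulaSize a)
  formulaSize (box r a) = suc (guardSize r + formulaSize a)

  guardSize : Guard n → ℕ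
  guardSize (gprop _) = 1
  guardSize (gtest ψ) = suc (formulaSize ψ)
  guardSize (gplus r s) = suc (guardSize r + guardSize s)
  guardSize (gseq r s) = suc (guardSize r + guardSize s)
  guardSize (gstar r) = suc (guardSize r)

siteSize : Site n → ℕ
siteSize (site r x _) = suc (guardSize r + formulaSize x)

-- What a leaf state requires at the end of the guard match: the body holds, fails, or nothing.
data Ending : Set where
  sat unsat free : Ending

-- [often]: infinitely many ends of guard matches satisfy the ending.
data Mode : Set where
  once often : Mode

Kind : Set
Kind = Fin 4 × Ending × Mode

modeRank : Mode → ℕ
modeRank once = 0
modeRank often = 1

data Node {n} (φ : Formula n) : Set where
  initial : Node φ
  at : Kind → Pos φ → Node φ

module Automaton {n : ℕ} (φ : Formula n) (β : B4) where

  -- A state of polarity false accepts exactly the words that the same state of polarity true rejects.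
  State : Set
  State = Bool × Node φ

  dualState : State → State
  dualState (b , v) = not b , v

  complement : PosBool State → PosBool State
  complement = dual dualState

  leafState : Kind → Pos φ → PosBool State
  leafState κ p = bstate (true , at κ p)

  -- δFormula ψ e i a: on reading a, check that bit i of the value of ψ is 1; e locates ψ's positions in φ.
  mutual
    δFormula : (ψ : Formula n) → (Pos ψ → Pos φ) → Fin 4 → Letter n → PosBool State
    δFormula (atom p) e i a = if lookup a p then btrue else bfalse
    δFormula (neg x) e i a = complement (⋀ λ j → δFormula x (e ∘ inNeg) j a)
    δFormula (conj x y) e i a = band (δFormula x (e ∘ inConjˡ) i a) (δFormula y (e ∘ inConjʳ) i a)
    δFormula (disj x y) e i a = bor (δFormula x (e ∘ inDisjˡ) i a) (δFormula y (e ∘ inDisjʳ) i a)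
    δFormula (impl x y) e i a =
      bor (⋀ λ j → bor (complement (δFormula x (e ∘ inImplˡ) j a)) (δFormula y (e ∘ inImplʳ) j a))
          (δFormula y (e ∘ inImplʳ) i a)
    δFormula (dia r x) e i a = δReach r x (e ∘ diaLeaf) (e ∘ diaGuard) (e ∘ diaBody) i sat a
    δFormula (box r x) e i a = ⋁≤ (λ j → δBoxBit r x (e ∘ boxLeaf) (e ∘ boxGuard) (e ∘ boxBody) j a) i

    δTest : (r : Guard n) → (GPos r → Pos φ) → TestPos r → Fin 4 → Letter n → PosBool State
    δTest (gtest ψ) e test i a = δFormula ψ (e ∘ inTest) i a
    δTest (gplus r s) e (plusˡ t) i a = δTest r (e ∘ plusˡ) t i a
    δTest (gplus r s) e (plusʳ t) i a = δTest s (e ∘ plusʳ) t i a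
    δTest (gseq r s) e (seqˡ t) i a = δTest r (e ∘ seqˡ) t i a
    δTest (gseq r s) e (seqʳ t) i a = δTest s (e ∘ seqʳ) t i a
    δTest (gstar r) e (star t) i a = δTest r (e ∘ star) t i a

    δEnd : (x : Formula n) → (Pos x → Pos φ) → Fin 4 → Ending → Letter n → PosBool State
    δEnd x eB i sat a = δFormula x eB i a
    δEnd x eB i unsat a = complement (δFormula x eB i a)
    δEnd x eB i free a = btrue

    -- Some match of r ends at a position satisfying the ending c (δReach), or infinitely many do (δOften).
    δReach δOften : (r : Guard n) (x : Formula n) → (Leaf r → Pos φ) → (GPos r → Pos φ) → (Pos x → Pos φ) →
      Fin 4 → Ending → Letter n → PosBool State
    δReach r x eL eT eB i c a =
      instantiate (unfold r a id id done) (λ t → δTest r eT t i a) (leafState (i , c , once) ∘ eL)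
        (δEnd x eB i c a)
    δOften r x eL eT eB i c a =
      instantiate (unfold r a id id done) (λ t → δTest r eT t i a) (leafState (i , c , often) ∘ eL) bfalse

    δBoxBit : (r : Guard n) (x : Formula n) → (Leaf r → Pos φ) → (GPos r → Pos φ) → (Pos x → Pos φ) →
      Fin 4 → Letter n → PosBool State
    δBoxBit r x eL eT eB fz a = complement (δReach r x eL eT eB fz unsat a)
    δBoxBit r x eL eT eB (fs fz) a =
      bor (band (δOften r x eL eT eB (fs fz) free a) (complement (δOften r x eL eT eB (fs fz) unsat a)))
          (band (complement (δOften r x eL eT eB (fs fz) free a))
            (complement (δReach r x eL eT eB (fs fz) unsat a)))
    δBoxBit r x eL eT eB (fs (fs fz)) a =
      bor (band (δOften r x eL eT eB (fs (fs fz)) free a) (δOften r x eL eT eB (fs (fs fz)) sat a))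
          (band (complement (δOften r x eL eT eB (fs (fs fz)) free a))
                (bor (δReach r x eL eT eB (fs (fs fz)) sat a)
                  (complement (δReach r x eL eT eB (fs (fs fz)) free a))))
    δBoxBit r x eL eT eB (fs (fs (fs fz))) a =
      bor (δReach r x eL eT eB (fs (fs (fs fz))) sat a)
        (complement (δReach r x eL eT eB (fs (fs (fs fz))) free a))

  δLeaf : (r : Guard n) (x : Formula n) → (Leaf r → Pos φ) → (GPos r → Pos φ) → (Pos x → Pos φ) →
    Kind → Leaf r → Letter n → PosBool State
  δLeaf r x eL eT eB (i , c , once) l a =
    instantiate (resume r l a id id done) (λ t → δTest r eT t i a) (leafState (i , c , once) ∘ eL)
      (δEnd x eB i c a)
  δLeaf r x eL eT eB (i , c , often) l a =
    band (δLeaf r x eL eT eB (i , c , once) l a)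
         (instantiate (resume r l a id id done) (λ t → δTest r eT t i a) (leafState (i , c , often) ∘ eL)
           bfalse)

  mutual
    δPos : (ψ : Formula n) → (Pos ψ → Pos φ) → Kind → Pos ψ → Letter n → PosBool State
    δPos (neg x) e κ (inNeg p) a = δPos x (e ∘ inNeg) κ p a
    δPos (conj x y) e κ (inConjˡ p) a = δPos x (e ∘ inConjˡ) κ p a
    δPos (conj x y) e κ (inConjʳ p) a = δPos y (e ∘ inConjʳ) κ p a
    δPos (disj x y) e κ (inDisjˡ p) a = δPos x (e ∘ inDisjˡ) κ p a
    δPos (disj x y) e κ (inDisjʳ p) a = δPos y (e ∘ inDisjʳ) κ p a
    δPos (impl x y) e κ (inImplˡ p) a = δPos x (e ∘ inImplˡ) κ p a
    δPos (impl x y) e κ (inImplʳ p) a = δPos y (e ∘ inImplʳ) κ p a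
    δPos (dia r x) e κ (diaLeaf l) a = δLeaf r x (e ∘ diaLeaf) (e ∘ diaGuard) (e ∘ diaBody) κ l a
    δPos (dia r x) e κ (diaGuard g) a = δGPos r (e ∘ diaGuard) κ g a
    δPos (dia r x) e κ (diaBody p) a = δPos x (e ∘ diaBody) κ p a
    δPos (box r x) e κ (boxLeaf l) a = δLeaf r x (e ∘ boxLeaf) (e ∘ boxGuard) (e ∘ boxBody) κ l a
    δPos (box r x) e κ (boxGuard g) a = δGPos r (e ∘ boxGuard) κ g a
    δPos (box r x) e κ (boxBody p) a = δPos x (e ∘ boxBody) κ p a

    δGPos : (r : Guard n) → (GPos r → Pos φ) → Kind → GPos r → Letter n → PosBool State
    δGPos (gtest ψ) e κ (inTest p) a = δPos ψ (e ∘ inTest) κ p a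
    δGPos (gplus r s) e κ (plusˡ g) a = δGPos r (e ∘ plusˡ) κ g a
    δGPos (gplus r s) e κ (plusʳ g) a = δGPos s (e ∘ plusʳ) κ g a
    δGPos (gseq r s) e κ (seqˡ g) a = δGPos r (e ∘ seqˡ) κ g a
    δGPos (gseq r s) e κ (seqʳ g) a = δGPos s (e ∘ seqʳ) κ g a
    δGPos (gstar r) e κ (star g) a = δGPos r (e ∘ star) κ g a

  δInitial : Letter n → PosBool State
  δInitial a = ⋀ λ i → if bit β i then δFormula φ id i a else btrue

  δNode : Node φ → Letter n → PosBool State
  δNode initial a = δInitial a
  δNode (at κ p) a = δPos φ id κ p a

  polarise : Bool → PosBool State → PosBool State
  polarise true X = X
  polarise false X = complement X

  δState : State → Letter n → PosBool State
  δState (b , v) a = polarise b (δNode v a)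

  -- A positive [once] leaf waits for the end of a match, which must come: its colour is odd.
  nodeColour : Node φ → ℕ
  nodeColour initial = 0
  nodeColour (at (_ , _ , once) _) = 1
  nodeColour (at (_ , _ , often) _) = 0

  colour : State → ℕ
  colour (true , v) = nodeColour v
  colour (false , v) = suc (nodeColour v)

  rank : State → ℕ
  rank (_ , initial) = 2 + 2 * formulaSize φ
  rank (_ , at (_ , _ , m) p) = modeRank m + 2 * siteSize (siteOf p)

  rank-dual : ∀ q → rank (dualState q) ≡ rank q
  rank-dual (_ , initial) = refl
  rank-dual (_ , at _ _) = refl

-- Correctness of the transitions

module Correctness (em : ExcludedMiddle 0ℓ) {n : ℕ} (φ : Formula n) (β : B4) (w : Trace n) where
  open Classical em
  open Automaton φ β
  open Matching w using (SemAt; Tests; Reaches; Resume; letter-at; unfold-correct; resume-correct)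

  Ends : Fin 4 → Ending → Formula n → ℕ → Set
  Ends i sat x p = SemAt i p x
  Ends i unsat x p = ¬ SemAt i p x
  Ends i free x p = ⊤

  LeafHolds : Kind → Site n → ℕ → Set
  LeafHolds (i , c , once) (site r x l) k = Resume i r l (Ends i c x) k
  LeafHolds (i , c , often) (site r x l) k = Infinite (λ j → Resume i r l (λ p → p ≡ j × Ends i c x p) k)

  Target : ℕ → Set
  Target k = ∀ i → T (bit β i) → SemAt i k φ

  NodeHolds : ℕ → Node φ → Set
  NodeHolds k initial = Target k
  NodeHolds k (at κ p) = LeafHolds κ (siteOf p) k

  -- The marking: the intended meaning of each state at position k, decided classically.
  holds : ℕ → State → Bool
  holds k (true , v) = ⌊ em {NodeHolds k v} ⌋
  holds k (false , v) = not (holds k (true , v))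

  holds⇔ : ∀ k v → T (holds k (true , v)) ⇔ NodeHolds k v
  holds⇔ k v = mk⇔ toWitness fromWitness

  holds-leaf : ∀ k κ {p : Pos φ} {s} → siteOf p ≡ s → T (holds k (true , at κ p)) ⇔ LeafHolds κ s k
  holds-leaf k κ {p} refl = holds⇔ k (at κ p)

  holds-dual : ∀ k q → T (holds k (dualState q)) ⇔ (¬ T (holds k q))
  holds-dual k (true , v) = T-not (holds k (true , v))
  holds-dual k (false , v) with holds k (true , v)
  ... | true = mk⇔ (λ _ ()) (λ _ → tt)
  ... | false = mk⇔ (λ ()) (λ ¬t → ¬t tt)

  ⊩-complement : ∀ k X → holds k ⊩ complement X ⇔ (¬ holds k ⊩ X)
  ⊩-complement k = ⊩-dual (holds k) (holds-dual k)

  ¬-complement : ∀ {A : Set} k X → A ⇔ holds k ⊩ X → (¬ A) ⇔ holds k ⊩ complement X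
  ¬-complement k X h = ⇔-trans (¬-cong-⇔ h) (⇔-sym (⊩-complement k X))

  module OccurrenceCorrect (r : Guard n) (x : Formula n)
    (eL : Leaf r → Pos φ) (eT : GPos r → Pos φ) (eB : Pos x → Pos φ)
    (leaf-site : ∀ l → siteOf (eL l) ≡ site r x l) (k : ℕ)
    (tests-ok : ∀ i t → holds (suc k) ⊩ δTest r eT t i (w k) ⇔ Tests i k t)
    (body-ok : ∀ i → SemAt i k x ⇔ holds (suc k) ⊩ δFormula x eB i (w k)) where

    S : State → Bool
    S = holds (suc k)

    end-ok : ∀ i c → S ⊩ δEnd x eB i c (w k) ⇔ Ends i c x k
    end-ok i sat = ⇔-sym (body-ok i)
    end-ok i unsat = ⇔-sym (¬-complement (suc k) (δFormula x eB i (w k)) (body-ok i))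
    end-ok i free = ⇔-refl

    leaf-ok : ∀ κ l → T (S (true , at κ (eL l))) ⇔ LeafHolds κ (site r x l) (suc k)
    leaf-ok κ l = holds-leaf (suc k) κ {eL l} (leaf-site l)

    once-ok : ∀ i c l → Resume i r l (Ends i c x) k ⇔ S ⊩ δLeaf r x eL eT eB (i , c , once) l (w k)
    once-ok i c l = ⇔-trans
      (resume-correct i r l k (Ends i c x) id id done _ _ _ (tests-ok i) (leaf-ok (i , c , once)) (end-ok i c))
      (⇔-sym (⊩-instantiate S (resume r l (w k) id id done) _ _ _))

    Often : Fin 4 → Ending → Set
    Often i c = Infinite (λ j → Reaches i r k (λ p → p ≡ j × Ends i c x p))

    reach-ok : ∀ i c → Reaches i r k (Ends i c x) ⇔ S ⊩ δReach r x eL eT eB i c (w k)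
    reach-ok i c = ⇔-trans
      (unfold-correct i r k (Ends i c x) id id done _ _ _ (tests-ok i) (leaf-ok (i , c , once)) (end-ok i c))
      (⇔-sym (⊩-instantiate S (unfold r (w k) id id done) _ _ _))

    often-ok : ∀ i c → Often i c ⇔ S ⊩ δOften r x eL eT eB i c (w k)
    often-ok i c = mk⇔ forth back
      where
      U = unfold r (w k) id id done
      τ : TestPos r → Set
      τ t = S ⊩ δTest r eT t i (w k)
      Λ : ℕ → Leaf r → Set
      Λ j l = Resume i r l (λ p → p ≡ j × Ends i c x p) (suc k)
      End : ℕ → Set
      End j = k ≡ j × Ends i c x k
      ending-at : ∀ j → Reaches i r k (λ p → p ≡ j × Ends i c x p) ⇔ ⟦ U ⟧ᴮ τ (Λ j) (End j)
      ending-at j = unfold-correct i r k _ id id done τ (Λ j) (End j) (tests-ok i) (λ _ → ⇔-refl) ⇔-refl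
      forth : Often i c → S ⊩ δOften r x eL eT eB i c (w k)
      forth inf = from (⊩-instantiate S U _ _ bfalse)
        (⟦⟧ᴮ-mono U (λ _ t → t) (λ l → from (leaf-ok (i , c , often) l)) (¬Infinite-singleton k _)
          (Infinite-⟦⟧ᴮ⇒ em U τ Λ End (λ N → let (j , j≥N , m) = inf N in j , j≥N , to (ending-at j) m)))
      back : S ⊩ δOften r x eL eT eB i c (w k) → Often i c
      back p N = let (j , j≥N , q) = Infinite-⟦⟧ᴮ⇐ U τ Λ End
                       (⟦⟧ᴮ-mono U (λ _ t → t) (λ l → to (leaf-ok (i , c , often) l)) ⊥-elim
                         (to (⊩-instantiate S U _ _ bfalse) p)) N
                 in j , j≥N , from (ending-at j) q

    Matches : Fin 4 → ℕ → Set
    Matches j t = Match j (suffix k w) r t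

    body-at : ∀ j t → Sem j (suffix t (suffix k w)) x ⇔ SemAt j (k + t) x
    body-at j t = mk⇔ (Sem-resp-≈ x (suffix-suffix w t k)) (Sem-resp-≈ x (≈-sym (suffix-suffix w t k)))

    some-ok : ∀ j →
      (∃[ t ] (Matches j t × Sem j (suffix t (suffix k w)) x)) ⇔ S ⊩ δReach r x eL eT eB j sat (w k)
    some-ok j = ⇔-trans (mk⇔ (λ (t , m , s) → t , m , to (body-at j t) s)
      (λ (t , m , s) → t , m , from (body-at j t) s))
                        (reach-ok j sat)

    none-ok : ∀ j → (¬ (∃[ t ] Matches j t)) ⇔ S ⊩ complement (δReach r x eL eT eB j free (w k))
    none-ok j = ⇔-trans (¬-cong-⇔ (mk⇔ (λ (t , m) → t , m , tt) (λ (t , m , _) → t , m)))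
                        (¬-complement (suc k) (δReach r x eL eT eB j free (w k)) (reach-ok j free))

    every-ok : ∀ j → (∀ t → Matches j t → Sem j (suffix t (suffix k w)) x) ⇔
      S ⊩ complement (δReach r x eL eT eB j unsat (w k))
    every-ok j = ⇔-trans (mk⇔ forth back)
      (¬-complement (suc k) (δReach r x eL eT eB j unsat (w k)) (reach-ok j unsat))
      where
      forth : (∀ t → Matches j t → Sem j (suffix t (suffix k w)) x) → ¬ Reaches j r k (Ends j unsat x)
      forth all (t , m , ¬s) = ¬s (to (body-at j t) (all t m))
      back : ¬ Reaches j r k (Ends j unsat x) → ∀ t → Matches j t → Sem j (suffix t (suffix k w)) x
      back none t m = from (body-at j t) (dne λ ¬s → none (t , m , ¬s))

    infinite-ok : ∀ j → Infinite (Matches j) ⇔ S ⊩ δOften r x eL eT eB j free (w k)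
    infinite-ok j = ⇔-trans (Infinite-cong (λ t → mk⇔ (_, tt) proj₁))
      (⇔-trans (Infinite-shift k (Matches j) (λ _ → ⊤)) (often-ok j free))

    finite-ok : ∀ j → (¬ Infinite (Matches j)) ⇔ S ⊩ complement (δOften r x eL eT eB j free (w k))
    finite-ok j = ¬-complement (suc k) (δOften r x eL eT eB j free (w k)) (infinite-ok j)

    infinitely-ok : ∀ j → (∀ j' → ∃[ t ] (t ≥ j' × Matches j t × Sem j (suffix t (suffix k w)) x)) ⇔
      S ⊩ δOften r x eL eT eB j sat (w k)
    infinitely-ok j = ⇔-trans (Infinite-cong (λ t → ⇔-refl ×-⇔ body-at j t))
      (⇔-trans (Infinite-shift k (Matches j) (λ p → SemAt j p x)) (often-ok j sat))

    eventually-ok : ∀ j → (∃[ j' ] (∀ t → t ≥ j' → Matches j t → Sem j (suffix t (suffix k w)) x)) ⇔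
      S ⊩ complement (δOften r x eL eT eB j unsat (w k))
    eventually-ok j = ⇔-trans (mk⇔ forth back)
      (¬-complement (suc k) (δOften r x eL eT eB j unsat (w k))
        (⇔-trans (Infinite-shift k (Matches j) (λ p → ¬ SemAt j p x)) (often-ok j unsat)))
      where
      forth : (∃[ j' ] (∀ t → t ≥ j' → Matches j t → Sem j (suffix t (suffix k w)) x)) →
        ¬ Infinite (λ t → Matches j t × ¬ SemAt j (k + t) x)
      forth (j' , all) inf = let (t , t≥j' , m , ¬s) = inf j' in ¬s (to (body-at j t) (all t t≥j' m))
      back : ¬ Infinite (λ t → Matches j t × ¬ SemAt j (k + t) x) →
        ∃[ j' ] (∀ t → t ≥ j' → Matches j t → Sem j (suffix t (suffix k w)) x)
      back ¬inf = let (N , none) = ¬Infinite⇒bounded ¬inf in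
        N , λ t t≥N m → from (body-at j t) (dne λ ¬s → none t t≥N (m , ¬s))

    box-bit-ok : ∀ j → BoxBit j (suffix k w) r x ⇔ S ⊩ δBoxBit r x eL eT eB j (w k)
    box-bit-ok fz = every-ok fz
    box-bit-ok (fs fz) = (infinite-ok _ ×-⇔ eventually-ok _) ⊎-⇔ (finite-ok _ ×-⇔ every-ok _)
    box-bit-ok (fs (fs fz)) = (infinite-ok _ ×-⇔ infinitely-ok _) ⊎-⇔
      (finite-ok _ ×-⇔ (some-ok _ ⊎-⇔ none-ok _))
    box-bit-ok (fs (fs (fs fz))) = some-ok _ ⊎-⇔ none-ok _

    box-ok : ∀ i → Sem i (suffix k w) (box r x) ⇔ S ⊩ ⋁≤ (λ j → δBoxBit r x eL eT eB j (w k)) i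
    box-ok i = ⇔-trans
      (mk⇔ (λ (j , j≤i , b) → j , j≤i , to (box-bit-ok j) b)
        (λ (j , j≤i , b) → j , j≤i , from (box-bit-ok j) b))
      (⇔-sym (⊩-⋁≤ S _ i))

  mutual
    δFormula-correct : (ψ : Formula n) (e : Pos ψ → Pos φ) → SitePreserving e →
      ∀ i k → SemAt i k ψ ⇔ holds (suc k) ⊩ δFormula ψ e i (w k)
    δFormula-correct (atom p) e sp i k = ⇔-trans
      (mk⇔ (subst (λ a → T (lookup a p)) (letter-at i k)) (subst (λ a → T (lookup a p)) (sym (letter-at i k))))
      (⇔-sym (⊩-if (holds (suc k)) (lookup (w k) p)))
    δFormula-correct (neg x) e sp i k = ¬-complement (suc k) (⋀ λ j → δFormula x (e ∘ inNeg) j (w k)) (⇔-trans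
      (∀-cong λ j → δFormula-correct x (e ∘ inNeg) (sp ∘ inNeg) j k)
      (⇔-sym (⊩-⋀ (holds (suc k)) λ j → δFormula x (e ∘ inNeg) j (w k))))
    δFormula-correct (conj x y) e sp i k =
      δFormula-correct x (e ∘ inConjˡ) (sp ∘ inConjˡ) i k ×-⇔
      δFormula-correct y (e ∘ inConjʳ) (sp ∘ inConjʳ) i k
    δFormula-correct (disj x y) e sp i k =
      δFormula-correct x (e ∘ inDisjˡ) (sp ∘ inDisjˡ) i k ⊎-⇔
      δFormula-correct y (e ∘ inDisjʳ) (sp ∘ inDisjʳ) i k
    δFormula-correct (impl x y) e sp i k =
      ⇔-trans (∀-cong λ j → ⇔-trans →⇔¬⊎
                 (¬-complement (suc k) (δFormula x (e ∘ inImplˡ) j (w k))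
                   (δFormula-correct x (e ∘ inImplˡ) (sp ∘ inImplˡ) j k) ⊎-⇔
                  δFormula-correct y (e ∘ inImplʳ) (sp ∘ inImplʳ) j k))
              (⇔-sym (⊩-⋀ (holds (suc k)) λ j →
                bor (complement (δFormula x (e ∘ inImplˡ) j (w k))) (δFormula y (e ∘ inImplʳ) j (w k))))
      ⊎-⇔ δFormula-correct y (e ∘ inImplʳ) (sp ∘ inImplʳ) i k
    δFormula-correct (dia r x) e sp i k = OccurrenceCorrect.some-ok r x _ _ _ (sp ∘ diaLeaf) k
      (λ j → δTest-correct r (e ∘ diaGuard) (sp ∘ diaGuard) j k)
        (λ j → δFormula-correct x (e ∘ diaBody) (sp ∘ diaBody) j k) i
    δFormula-correct (box r x) e sp i k = OccurrenceCorrect.box-ok r x _ _ _ (sp ∘ boxLeaf) k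
      (λ j → δTest-correct r (e ∘ boxGuard) (sp ∘ boxGuard) j k)
        (λ j → δFormula-correct x (e ∘ boxBody) (sp ∘ boxBody) j k) i

    δTest-correct : (r : Guard n) (e : GPos r → Pos φ) → SitePreservingᴳ e →
      ∀ i k t → holds (suc k) ⊩ δTest r e t i (w k) ⇔ Tests i k t
    δTest-correct (gtest ψ) e sp i k test = ⇔-sym (δFormula-correct ψ (e ∘ inTest) (sp ∘ inTest) i k)
    δTest-correct (gplus r s) e sp i k (plusˡ t) = δTest-correct r (e ∘ plusˡ) (sp ∘ plusˡ) i k t
    δTest-correct (gplus r s) e sp i k (plusʳ t) = δTest-correct s (e ∘ plusʳ) (sp ∘ plusʳ) i k t
    δTest-correct (gseq r s) e sp i k (seqˡ t) = δTest-correct r (e ∘ seqˡ) (sp ∘ seqˡ) i k t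
    δTest-correct (gseq r s) e sp i k (seqʳ t) = δTest-correct s (e ∘ seqʳ) (sp ∘ seqʳ) i k t
    δTest-correct (gstar r) e sp i k (star t) = δTest-correct r (e ∘ star) (sp ∘ star) i k t

-- Ranks

occRank : Guard n → Formula n → ℕ
occRank r x = 2 * suc (guardSize r + formulaSize x)

module Ranking {n : ℕ} (φ : Formula n) (β : B4) where
  open Automaton φ β

  Below : ℕ → State → Set
  Below c q = rank q < c

  below-mono : ∀ {c c'} X → c ≤ c' → Every (Below c) X → Every (Below c') X
  below-mono X c≤c' = Every-mono X (λ _ lt → <-≤-trans lt c≤c')

  Every-complement : ∀ {c} X → Every (Below c) X → Every (Below c) (complement X)
  Every-complement X = Every-dual X (λ q lt → subst (_< _) (sym (rank-dual q)) lt)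

  module OccurrenceRanks (r : Guard n) (x : Formula n)
    (eL : Leaf r → Pos φ) (eT : GPos r → Pos φ) (eB : Pos x → Pos φ)
    (leaf-site : ∀ l → siteOf (eL l) ≡ site r x l)
    (tests-below : ∀ t i a → Every (Below (occRank r x)) (δTest r eT t i a))
    (body-below : ∀ i a → Every (Below (occRank r x)) (δFormula x eB i a)) where

    leaf-rank : ∀ b i c m l → rank (b , at (i , c , m) (eL l)) ≡ modeRank m + occRank r x
    leaf-rank b i c m l = cong (λ s → modeRank m + 2 * siteSize s) (leaf-site l)

    leaf-below : ∀ i c m l → Below (2 + occRank r x) (true , at (i , c , m) (eL l))
    leaf-below i c once l = ≤-trans (≤-reflexive (cong suc (leaf-rank true i c once l))) (n≤1+n _)
    leaf-below i c often l = ≤-reflexive (cong suc (leaf-rank true i c often l))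

    end-below : ∀ i c a → Every (Below (occRank r x)) (δEnd x eB i c a)
    end-below i sat a = body-below i a
    end-below i unsat a = Every-complement (δFormula x eB i a) (body-below i a)
    end-below i free a = tt

    tests-below′ : ∀ i a t → Every (Below (2 + occRank r x)) (δTest r eT t i a)
    tests-below′ i a t = below-mono (δTest r eT t i a) (m≤n+m _ 2) (tests-below t i a)

    reach-below : ∀ i c a → Every (Below (2 + occRank r x)) (δReach r x eL eT eB i c a)
    reach-below i c a = Every-instantiate (unfold r a id id done) _ _ _ (tests-below′ i a)
      (leaf-below i c once) (below-mono (δEnd x eB i c a) (m≤n+m _ 2) (end-below i c a))

    often-below : ∀ i c a → Every (Below (2 + occRank r x)) (δOften r x eL eT eB i c a)
    often-below i c a = Every-instantiate (unfold r a id id done) _ _ _ (tests-below′ i a)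
      (leaf-below i c often) tt

    reach-below-co : ∀ i c a → Every (Below (2 + occRank r x)) (complement (δReach r x eL eT eB i c a))
    reach-below-co i c a = Every-complement (δReach r x eL eT eB i c a) (reach-below i c a)

    often-below-co : ∀ i c a → Every (Below (2 + occRank r x)) (complement (δOften r x eL eT eB i c a))
    often-below-co i c a = Every-complement (δOften r x eL eT eB i c a) (often-below i c a)

    box-bit-below : ∀ j a → Every (Below (2 + occRank r x)) (δBoxBit r x eL eT eB j a)
    box-bit-below fz a = reach-below-co _ _ a
    box-bit-below (fs fz) a =
      (often-below _ _ a , often-below-co _ _ a) , (often-below-co _ _ a , reach-below-co _ _ a)
    box-bit-below (fs (fs fz)) a =
      (often-below _ _ a , often-below _ _ a) ,
        (often-below-co _ _ a , (reach-below _ _ a , reach-below-co _ _ a))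
    box-bit-below (fs (fs (fs fz))) a = reach-below _ _ a , reach-below-co _ _ a

    once-parts : ∀ i c l a → Every
      (λ q → Below (occRank r x) q ⊎ ∃[ l' ] (q ≡ (true , at (i , c , once) (eL l'))))
      (δLeaf r x eL eT eB (i , c , once) l a)
    once-parts i c l a = Every-instantiate (resume r l a id id done) _ _ _
      (λ t → Every-mono (δTest r eT t i a) (λ _ → inj₁) (tests-below t i a)) (λ l' → inj₂ (l' , refl))
      (Every-mono (δEnd x eB i c a) (λ _ → inj₁) (end-below i c a))

    once-below : ∀ i c l a → Every (Below (suc (occRank r x))) (δLeaf r x eL eT eB (i , c , once) l a)
    once-below i c l a = Every-mono (δLeaf r x eL eT eB (i , c , once) l a) bound (once-parts i c l a)
      where
      bound : ∀ q → Below (occRank r x) q ⊎ ∃[ l' ] (q ≡ (true , at (i , c , once) (eL l'))) → Below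
        (suc (occRank r x)) q
      bound q (inj₁ lt) = m<n⇒m<1+n lt
      bound q (inj₂ (l' , refl)) = s≤s (≤-reflexive (leaf-rank true i c once l'))

  mutual
    δFormula-below : (ψ : Formula n) (e : Pos ψ → Pos φ) → SitePreserving e →
      ∀ i a → Every (Below (2 + 2 * formulaSize ψ)) (δFormula ψ e i a)
    δFormula-below (atom p) e sp i a = Every-if (lookup a p)
    δFormula-below (neg x) e sp i a = Every-complement (⋀ λ j → δFormula x (e ∘ inNeg) j a)
      (Every-⋀ (λ j → δFormula x (e ∘ inNeg) j a) λ j →
      below-mono (δFormula x _ j a) (2+2*-mono (n≤1+n (formulaSize x)))
        (δFormula-below x (e ∘ inNeg) (sp ∘ inNeg) j a))
    δFormula-below (conj x y) e sp i a =
      below-mono (δFormula x _ i a) (2+2*-mono (≤-suc-+ˡ (formulaSize x) (formulaSize y)))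
        (δFormula-below x (e ∘ inConjˡ) (sp ∘ inConjˡ) i a) ,
      below-mono (δFormula y _ i a) (2+2*-mono (≤-suc-+ʳ (formulaSize x) (formulaSize y)))
        (δFormula-below y (e ∘ inConjʳ) (sp ∘ inConjʳ) i a)
    δFormula-below (disj x y) e sp i a =
      below-mono (δFormula x _ i a) (2+2*-mono (≤-suc-+ˡ (formulaSize x) (formulaSize y)))
        (δFormula-below x (e ∘ inDisjˡ) (sp ∘ inDisjˡ) i a) ,
      below-mono (δFormula y _ i a) (2+2*-mono (≤-suc-+ʳ (formulaSize x) (formulaSize y)))
        (δFormula-below y (e ∘ inDisjʳ) (sp ∘ inDisjʳ) i a)
    δFormula-below (impl x y) e sp i a =
      Every-⋀ (λ j → bor (complement (δFormula x (e ∘ inImplˡ) j a)) (δFormula y (e ∘ inImplʳ) j a)) (λ j →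
        Every-complement (δFormula x (e ∘ inImplˡ) j a)
          (below-mono (δFormula x _ j a) (2+2*-mono (≤-suc-+ˡ (formulaSize x) (formulaSize y)))
          (δFormula-below x (e ∘ inImplˡ) (sp ∘ inImplˡ) j a)) ,
        below-mono (δFormula y _ j a) (2+2*-mono (≤-suc-+ʳ (formulaSize x) (formulaSize y)))
          (δFormula-below y (e ∘ inImplʳ) (sp ∘ inImplʳ) j a)) ,
      below-mono (δFormula y _ i a) (2+2*-mono (≤-suc-+ʳ (formulaSize x) (formulaSize y)))
        (δFormula-below y (e ∘ inImplʳ) (sp ∘ inImplʳ) i a)
    δFormula-below (dia r x) e sp i a = OccurrenceRanks.reach-below r x _ _ _ (sp ∘ diaLeaf)
      (tests-occ-below r x (e ∘ diaGuard) (sp ∘ diaGuard)) (body-occ-below r x (e ∘ diaBody) (sp ∘ diaBody))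
      i sat a
    δFormula-below (box r x) e sp i a = Every-⋁≤ _ (λ j → OccurrenceRanks.box-bit-below r x _ _ _ (sp ∘ boxLeaf)
      (tests-occ-below r x (e ∘ boxGuard) (sp ∘ boxGuard)) (body-occ-below r x (e ∘ boxBody) (sp ∘ boxBody))
      j a) i

    δTest-below : (r : Guard n) (e : GPos r → Pos φ) → SitePreservingᴳ e →
      ∀ t i a → Every (Below (2 * guardSize r)) (δTest r e t i a)
    δTest-below (gtest ψ) e sp test i a = below-mono (δFormula ψ _ i a) (≤-reflexive (sym (*-suc 2 _)))
      (δFormula-below ψ (e ∘ inTest) (sp ∘ inTest) i a)
    δTest-below (gplus r s) e sp (plusˡ t) i a = below-mono (δTest r _ t i a)
      (*-monoʳ-≤ 2 (≤-suc-+ˡ (guardSize r) (guardSize s)))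
      (δTest-below r (e ∘ plusˡ) (sp ∘ plusˡ) t i a)
    δTest-below (gplus r s) e sp (plusʳ t) i a = below-mono (δTest s _ t i a)
      (*-monoʳ-≤ 2 (≤-suc-+ʳ (guardSize r) (guardSize s)))
      (δTest-below s (e ∘ plusʳ) (sp ∘ plusʳ) t i a)
    δTest-below (gseq r s) e sp (seqˡ t) i a = below-mono (δTest r _ t i a)
      (*-monoʳ-≤ 2 (≤-suc-+ˡ (guardSize r) (guardSize s)))
      (δTest-below r (e ∘ seqˡ) (sp ∘ seqˡ) t i a)
    δTest-below (gseq r s) e sp (seqʳ t) i a = below-mono (δTest s _ t i a)
      (*-monoʳ-≤ 2 (≤-suc-+ʳ (guardSize r) (guardSize s)))
      (δTest-below s (e ∘ seqʳ) (sp ∘ seqʳ) t i a)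
    δTest-below (gstar r) e sp (star t) i a = below-mono (δTest r _ t i a) (*-monoʳ-≤ 2 (n≤1+n _))
      (δTest-below r (e ∘ star) (sp ∘ star) t i a)

    tests-occ-below : ∀ r x (eT : GPos r → Pos φ) → SitePreservingᴳ eT →
      ∀ t i a → Every (Below (occRank r x)) (δTest r eT t i a)
    tests-occ-below r x eT sp t i a =
      below-mono (δTest r eT t i a) (*-monoʳ-≤ 2 (≤-suc-+ˡ (guardSize r) (formulaSize x)))
        (δTest-below r eT sp t i a)

    body-occ-below : ∀ r x (eB : Pos x → Pos φ) → SitePreserving eB →
      ∀ i a → Every (Below (occRank r x)) (δFormula x eB i a)
    body-occ-below r x eB sp i a = below-mono (δFormula x eB i a)
      (≤-trans (2+2*-mono (m≤n+m _ (guardSize r))) (≤-reflexive (sym (*-suc 2 _)))) (δFormula-below x eB sp i a)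

-- Consistency of the marking

module Consistency (em : ExcludedMiddle 0ℓ) {n : ℕ} (φ : Formula n) (β : B4) (w : Trace n) where
  open Classical em
  open Automaton φ β
  open Ranking φ β
  open Correctness em φ β w
  open Matching w using (Tests; Resume; Resume-mono; Resume-∃; Resume-bounded; resume-correct)

  EndsAt : Fin 4 → Ending → Site n → ℕ → ℕ → Set
  EndsAt i c (site r x l) k j = Resume i r l (λ p → p ≡ j × Ends i c x p) k

  firstEnd lastEnd : Fin 4 → Ending → Site n → ℕ → ℕ
  firstEnd i c s k = μ (EndsAt i c s k)
  lastEnd i c s k = μ (λ N → ∀ j → j ≥ N → ¬ EndsAt i c s k j)

  -- The states of odd colour are the pending positive [once] leaves, which must reach an end of the
  -- match, and the refuted negative [often] leaves, which must pass the last end; both distances shrink.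
  progress : ℕ → State → ℕ
  progress k (true , at (i , c , once) p) = firstEnd i c (siteOf p) k ∸ k
  progress k (false , at (i , c , often) p) = lastEnd i c (siteOf p) k ∸ k
  progress k _ = 0

  Good : ℕ → State → State → Set
  Good = GoodSuccessor holds rank colour progress

  SuccessorsIn : ℕ → State → (State → Bool) → Set
  SuccessorsIn k q S = ∀ q' → Good k q q' → T (S q')

  Consistent : ℕ → State → Set
  Consistent k q = T (holds k q) → ∀ S → SuccessorsIn k q S → S ⊩ δState q (w k)

  good-if-lower : ∀ k q q' → rank q' < rank q → T (holds (suc k) q') → Good k q q'
  good-if-lower k q q' lt h = h , <⇒≤ lt , λ eq → ⊥-elim (<-irrefl eq lt)

  module Successors {k : ℕ} {S : State → Bool} (q : State) (succ : SuccessorsIn k q S) where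

    lower : ∀ X c → c ≤ rank q → Every (Below c) X → holds (suc k) ⊩ X → S ⊩ X
    lower X c c≤ below = ⊩-mono-Every X below λ q' lt h → succ q' (good-if-lower k q q' (<-≤-trans lt c≤) h)

    holds-unless-dual : ∀ q' → (¬ T (holds (suc k) q') → Good k q (dualState q')) →
      T (not (S (dualState q'))) → T (holds (suc k) q')
    holds-unless-dual q' good s = dne λ ¬h → to (T-not _) s (succ _ (good ¬h))

    holds-if-lower-dual : ∀ q' → rank q' < rank q → T (not (S (dualState q'))) → T (holds (suc k) q')
    holds-if-lower-dual q' lt = holds-unless-dual q' λ ¬h →
      good-if-lower k q (dualState q') (subst (_< _) (sym (rank-dual q')) lt) (from (holds-dual (suc k) q') ¬h)

    lower-dual : ∀ X c → c ≤ rank q → Every (Below c) X → (not ∘ S ∘ dualState) ⊩ X → holds (suc k) ⊩ X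
    lower-dual X c c≤ below = ⊩-mono-Every X below λ q' lt → holds-if-lower-dual q' (<-≤-trans lt c≤)

  ⊩-δInitial : ∀ (S : State → Bool) a → S ⊩ δInitial a ⇔ (∀ i → T (bit β i) → S ⊩ δFormula φ id i a)
  ⊩-δInitial S a = ⇔-trans (⊩-⋀ S λ i → if bit β i then δFormula φ id i a else btrue)
    (∀-cong λ i → ⊩-if-else-true S (bit β i) _)

  initial-consistent : ∀ b k → Consistent k (b , initial)
  initial-consistent true k h S succ = from (⊩-δInitial S (w k)) λ i t →
    Successors.lower (true , initial) succ (δFormula φ id i (w k)) _ ≤-refl
      (δFormula-below φ id (λ _ → refl) i (w k))
      (to (δFormula-correct φ id (λ _ → refl) i k) (toWitness h i t))
  initial-consistent false k h S succ = ⊩-dual-complement S (δInitial (w k)) λ s →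
    to (T-not _) h (fromWitness λ i t → from (δFormula-correct φ id (λ _ → refl) i k)
      (Successors.lower-dual (false , initial) succ (δFormula φ id i (w k)) _ ≤-refl
        (δFormula-below φ id (λ _ → refl) i (w k))
        (to (⊩-δInitial _ (w k)) s i t)))

  module LeafConsistency (r : Guard n) (x : Formula n)
    (eL : Leaf r → Pos φ) (eT : GPos r → Pos φ) (eB : Pos x → Pos φ)
      (leaf-site : ∀ l → siteOf (eL l) ≡ site r x l)
    (tests-site : SitePreservingᴳ eT) (body-site : SitePreserving eB) where

    open OccurrenceRanks r x eL eT eB leaf-site (tests-occ-below r x eT tests-site)
      (body-occ-below r x eB body-site)
    module Occ k = OccurrenceCorrect r x eL eT eB leaf-site k
      (λ i → δTest-correct r eT tests-site i k) (λ i → δFormula-correct x eB body-site i k)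

    LeafConsistent : Bool → Kind → Leaf r → ℕ → Set
    LeafConsistent b κ l k = T (holds k (b , at κ (eL l))) → ∀ S → SuccessorsIn k (b , at κ (eL l)) S →
      S ⊩ polarise b (δLeaf r x eL eT eB κ l (w k))

    Rest : Leaf r → ℕ → Branching (TestPos r) (Leaf r)
    Rest l k = resume r l (w k) id id done

    ends-step : ∀ i c l k j → EndsAt i c (site r x l) k j ⇔
      ⟦ Rest l k ⟧ᴮ (Tests i k) (λ l' → EndsAt i c (site r x l') (suc k) j) (k ≡ j × Ends i c x k)
    ends-step i c l k j = resume-correct i r l k _ id id done _ _ _ (λ _ → ⇔-refl) (λ _ → ⇔-refl) ⇔-refl

    some-end : ∀ i c l k → Resume i r l (Ends i c x) k → ∃ (EndsAt i c (site r x l) k)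
    some-end i c l k = Resume-∃ i r l k _ ∘ Resume-mono i r l k (λ p e → p , refl , e)

    end-after : ∀ i c l k j → EndsAt i c (site r x l) k j → k ≤ j
    end-after i c l k j = Resume-bounded i r l k j (λ _ (p≡j , _) → ≤-reflexive p≡j)

    leaf-holds : ∀ k κ l → T (holds k (true , at κ (eL l))) ⇔ LeafHolds κ (site r x l) k
    leaf-holds k κ l = holds-leaf k κ {eL l} (leaf-site l)

    occRank≤ : ∀ b i c m l → occRank r x ≤ rank (b , at (i , c , m) (eL l))
    occRank≤ b i c m l = ≤-trans (m≤n+m _ (modeRank m)) (≤-reflexive (sym (leaf-rank b i c m l)))

    same-rank : ∀ b i c m l l' → rank (b , at (i , c , m) (eL l')) ≤ rank (b , at (i , c , m) (eL l))
    same-rank b i c m l l' = ≤-reflexive (≡.trans (leaf-rank b i c m l') (sym (leaf-rank b i c m l)))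

    first-end-shrinks : ∀ i c l l' k → EndsAt i c (site r x l') (suc k) (firstEnd i c (site r x l) k) →
      progress (suc k) (true , at (i , c , once) (eL l')) < progress k (true , at (i , c , once) (eL l))
    first-end-shrinks i c l l' k ends = subst₂ _<_
      (cong (λ s → firstEnd i c s (suc k) ∸ suc k) (sym (leaf-site l')))
        (cong (λ s → firstEnd i c s k ∸ k) (sym (leaf-site l)))
      (∸-shrinks (proj₂ (μ-minimal (_ , ends)) _ ends) (end-after i c l' (suc k) _ ends))

    last-end-shrinks : ∀ i c l l' k → ¬ Infinite (EndsAt i c (site r x l) k) → ∃ (EndsAt i c (site r x l) k) →
      (∀ j → EndsAt i c (site r x l') (suc k) j → EndsAt i c (site r x l) k j) →
      progress (suc k) (false , at (i , c , often) (eL l')) < progress k (false , at (i , c , often) (eL l))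
    last-end-shrinks i c l l' k finitely (j₀ , end₀) inherit = subst₂ _<_
      (cong (λ s → lastEnd i c s (suc k) ∸ suc k) (sym (leaf-site l')))
        (cong (λ s → lastEnd i c s k ∸ k) (sym (leaf-site l)))
      (∸-shrinks (proj₂ (μ-minimal (_ , bounded')) _ bounded')
                 (≤-trans (s≤s (end-after i c l k j₀ end₀)) (≰⇒> λ N≤j₀ → bounded _ N≤j₀ end₀)))
      where
      bounded = proj₁ (μ-minimal (¬Infinite⇒bounded finitely))
      bounded' = λ j j≥N e → bounded j j≥N (inherit j e)

    -- A refuted [often] leaf whose dual fails its transition passes the refutation on to a leaf of
    -- the next position, all of whose match ends are ends of the current one.
    often-successor : ∀ i c l k {S} → SuccessorsIn k (false , at (i , c , often) (eL l)) S →
      (not ∘ S ∘ dualState) ⊩ instantiate (Rest l k) (λ t → δTest r eT t i (w k))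
        (leafState (i , c , often) ∘ eL) bfalse →
      ∃[ l' ] (T (not (S (false , at (i , c , often) (eL l')))) ×
               (∀ j → EndsAt i c (site r x l') (suc k) j → EndsAt i c (site r x l) k j))
    often-successor i c l k {S} succ s with ⟦⟧ᴮ-leaf (Rest l k) (Tests i k) _
      (⟦⟧ᴮ-mono (Rest l k) tests⇐ (λ _ s → s) (λ s → s) (to (⊩-instantiate _ (Rest l k) _ _ bfalse) s))
      where
      open Successors (false , at (i , c , often) (eL l)) succ
      tests⇐ : ∀ t → (not ∘ S ∘ dualState) ⊩ δTest r eT t i (w k) → Tests i k t
      tests⇐ t s = to (δTest-correct r eT tests-site i k t) (lower-dual (δTest r eT t i (w k)) _
        (occRank≤ false i c often l) (tests-occ-below r x eT tests-site t i (w k)) s)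
    ... | l' , s' , rebuild = l' , s' , λ j e → from (ends-step i c l k j) (rebuild _ _ e)

    pending-once : ∀ i c l k → LeafConsistent true (i , c , once) l k
    pending-once i c l k h S succ = from (⊩-instantiate S (Rest l k) _ _ _)
      (⟦⟧ᴮ-mono (Rest l k) tests⇒ leaves⇒ end⇒
        (to (ends-step i c l k _) (proj₁ (μ-minimal (some-end i c l k pending)))))
      where
      open Successors (true , at (i , c , once) (eL l)) succ
      pending : Resume i r l (Ends i c x) k
      pending = to (leaf-holds k (i , c , once) l) h
      tests⇒ : ∀ t → Tests i k t → S ⊩ δTest r eT t i (w k)
      tests⇒ t holds-t = lower (δTest r eT t i (w k)) _ (occRank≤ true i c once l)
        (tests-occ-below r x eT tests-site t i (w k)) (from (δTest-correct r eT tests-site i k t) holds-t)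
      leaves⇒ : ∀ l' → EndsAt i c (site r x l') (suc k) (firstEnd i c (site r x l) k) →
        T (S (true , at (i , c , once) (eL l')))
      leaves⇒ l' ends = succ _
        (from (leaf-holds (suc k) (i , c , once) l') (Resume-mono i r l' (suc k) (λ _ → proj₂) ends) ,
        same-rank true i c once l l' , λ _ → refl , λ _ → first-end-shrinks i c l l' k ends)
      end⇒ : k ≡ firstEnd i c (site r x l) k × Ends i c x k → S ⊩ δEnd x eB i c (w k)
      end⇒ (_ , e) = lower (δEnd x eB i c (w k)) _ (occRank≤ true i c once l) (end-below i c (w k))
        (from (Occ.end-ok k i c) e)

    pending-often : ∀ i c l k → LeafConsistent true (i , c , often) l k
    pending-often i c l k h S succ = once-part , often-part
      where
      open Successors (true , at (i , c , often) (eL l)) succ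
      infinitely : Infinite (EndsAt i c (site r x l) k)
      infinitely = to (leaf-holds k (i , c , often) l) h
      once-part : S ⊩ δLeaf r x eL eT eB (i , c , once) l (w k)
      once-part = lower (δLeaf r x eL eT eB (i , c , once) l (w k)) _
        (≤-reflexive (sym (leaf-rank true i c often l)))
        (once-below i c l (w k))
          (to (Occ.once-ok k i c l) (Resume-mono i r l k (λ _ → proj₂) (proj₂ (proj₂ (infinitely 0)))))
      tests⇒ : ∀ t → Tests i k t → S ⊩ δTest r eT t i (w k)
      tests⇒ t holds-t = lower (δTest r eT t i (w k)) _ (occRank≤ true i c often l)
        (tests-occ-below r x eT tests-site t i (w k)) (from (δTest-correct r eT tests-site i k t) holds-t)
      leaves⇒ : ∀ l' → Infinite (EndsAt i c (site r x l') (suc k)) → T (S (true , at (i , c , often) (eL l')))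
      leaves⇒ l' inf = succ _
        (from (leaf-holds (suc k) (i , c , often) l') inf , same-rank true i c often l l' ,
        λ _ → refl , λ odd → ⊥-elim (odd (0 , refl)))
      often-part :
        S ⊩ instantiate (Rest l k) (λ t → δTest r eT t i (w k)) (leafState (i , c , often) ∘ eL) bfalse
      often-part = from (⊩-instantiate S (Rest l k) _ _ bfalse)
        (⟦⟧ᴮ-mono (Rest l k) tests⇒ leaves⇒ (¬Infinite-singleton k _)
        (Infinite-⟦⟧ᴮ⇒ em (Rest l k) (Tests i k) (λ j l' → EndsAt i c (site r x l') (suc k) j)
          (λ j → k ≡ j × Ends i c x k)
          (Infinite-mono (λ j → to (ends-step i c l k j)) infinitely)))

    refuted-once : ∀ i c l k → LeafConsistent false (i , c , once) l k
    refuted-once i c l k h S succ = ⊩-dual-complement S (δLeaf r x eL eT eB (i , c , once) l (w k)) λ s →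
      to (T-not _) h (from (leaf-holds k (i , c , once) l) (from (Occ.once-ok k i c l)
        (⊩-mono-Every (δLeaf r x eL eT eB (i , c , once) l (w k)) (once-parts i c l (w k)) holds⇐ s)))
      where
      open Successors (false , at (i , c , once) (eL l)) succ
      holds⇐ : ∀ q' → Below (occRank r x) q' ⊎ ∃[ l' ] (q' ≡ (true , at (i , c , once) (eL l'))) →
        T (not (S (dualState q'))) → T (holds (suc k) q')
      holds⇐ q' (inj₁ lt) = holds-if-lower-dual q' (<-≤-trans lt (occRank≤ false i c once l))
      holds⇐ _ (inj₂ (l' , refl)) = holds-unless-dual _ λ ¬h →
        from (holds-dual (suc k) (true , at (i , c , once) (eL l'))) ¬h , same-rank false i c once l l' ,
        λ _ → refl , λ odd → ⊥-elim (odd (1 , refl))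

    refuted-often : ∀ i c l k → LeafConsistent false (i , c , often) l k
    refuted-often i c l k h S succ = ⊩-dual-complement S (δLeaf r x eL eT eB (i , c , often) l (w k)) refute
      where
      open Successors (false , at (i , c , often) (eL l)) succ
      finitely : ¬ Infinite (EndsAt i c (site r x l) k)
      finitely = to (T-not _) h ∘ from (leaf-holds k (i , c , often) l)
      refute : ¬ ((not ∘ S ∘ dualState) ⊩ δLeaf r x eL eT eB (i , c , often) l (w k))
      refute (s-once , s-often) with often-successor i c l k succ s-often
      ... | l' , s' , inherit with T? (holds (suc k) (true , at (i , c , often) (eL l')))
      ...   | yes h' = finitely (Infinite-mono inherit (to (leaf-holds (suc k) (i , c , often) l') h'))
      ...   | no ¬h' = to (T-not _) s'
        (succ _ (from (holds-dual (suc k) (true , at (i , c , often) (eL l'))) ¬h' ,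
        same-rank false i c often l l' , λ _ → refl , λ _ → last-end-shrinks i c l l' k finitely ends inherit))
        where
        ends : ∃ (EndsAt i c (site r x l) k)
        ends = some-end i c l k (from (Occ.once-ok k i c l)
          (lower-dual (δLeaf r x eL eT eB (i , c , once) l (w k)) _
            (≤-reflexive (sym (leaf-rank false i c often l)))
            (once-below i c l (w k)) s-once))

    leaf-consistent : ∀ b κ l k → LeafConsistent b κ l k
    leaf-consistent true (i , c , once) = pending-once i c
    leaf-consistent true (i , c , often) = pending-often i c
    leaf-consistent false (i , c , once) = refuted-once i c
    leaf-consistent false (i , c , often) = refuted-often i c

  mutual
    pos-consistent : (ψ : Formula n) (e : Pos ψ → Pos φ) → SitePreserving e → ∀ b κ p k →
      T (holds k (b , at κ (e p))) → ∀ S → SuccessorsIn k (b , at κ (e p)) S → S ⊩ polarise b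
        (δPos ψ e κ p (w k))
    pos-consistent (neg x) e sp b κ (inNeg p) = pos-consistent x (e ∘ inNeg) (sp ∘ inNeg) b κ p
    pos-consistent (conj x y) e sp b κ (inConjˡ p) = pos-consistent x (e ∘ inConjˡ) (sp ∘ inConjˡ) b κ p
    pos-consistent (conj x y) e sp b κ (inConjʳ p) = pos-consistent y (e ∘ inConjʳ) (sp ∘ inConjʳ) b κ p
    pos-consistent (disj x y) e sp b κ (inDisjˡ p) = pos-consistent x (e ∘ inDisjˡ) (sp ∘ inDisjˡ) b κ p
    pos-consistent (disj x y) e sp b κ (inDisjʳ p) = pos-consistent y (e ∘ inDisjʳ) (sp ∘ inDisjʳ) b κ p
    pos-consistent (impl x y) e sp b κ (inImplˡ p) = pos-consistent x (e ∘ inImplˡ) (sp ∘ inImplˡ) b κ p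
    pos-consistent (impl x y) e sp b κ (inImplʳ p) = pos-consistent y (e ∘ inImplʳ) (sp ∘ inImplʳ) b κ p
    pos-consistent (dia r x) e sp b κ (diaLeaf l) = LeafConsistency.leaf-consistent r x _ _ _
      (sp ∘ diaLeaf) (sp ∘ diaGuard) (sp ∘ diaBody) b κ l
    pos-consistent (dia r x) e sp b κ (diaGuard g) = gpos-consistent r (e ∘ diaGuard) (sp ∘ diaGuard) b κ g
    pos-consistent (dia r x) e sp b κ (diaBody p) = pos-consistent x (e ∘ diaBody) (sp ∘ diaBody) b κ p
    pos-consistent (box r x) e sp b κ (boxLeaf l) = LeafConsistency.leaf-consistent r x _ _ _
      (sp ∘ boxLeaf) (sp ∘ boxGuard) (sp ∘ boxBody) b κ l
    pos-consistent (box r x) e sp b κ (boxGuard g) = gpos-consistent r (e ∘ boxGuard) (sp ∘ boxGuard) b κ g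
    pos-consistent (box r x) e sp b κ (boxBody p) = pos-consistent x (e ∘ boxBody) (sp ∘ boxBody) b κ p

    gpos-consistent : (r : Guard n) (e : GPos r → Pos φ) → SitePreservingᴳ e → ∀ b κ g k →
      T (holds k (b , at κ (e g))) → ∀ S → SuccessorsIn k (b , at κ (e g)) S → S ⊩ polarise b
        (δGPos r e κ g (w k))
    gpos-consistent (gtest ψ) e sp b κ (inTest p) = pos-consistent ψ (e ∘ inTest) (sp ∘ inTest) b κ p
    gpos-consistent (gplus r s) e sp b κ (plusˡ g) = gpos-consistent r (e ∘ plusˡ) (sp ∘ plusˡ) b κ g
    gpos-consistent (gplus r s) e sp b κ (plusʳ g) = gpos-consistent s (e ∘ plusʳ) (sp ∘ plusʳ) b κ g
    gpos-consistent (gseq r s) e sp b κ (seqˡ g) = gpos-consistent r (e ∘ seqˡ) (sp ∘ seqˡ) b κ g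
    gpos-consistent (gseq r s) e sp b κ (seqʳ g) = gpos-consistent s (e ∘ seqʳ) (sp ∘ seqʳ) b κ g
    gpos-consistent (gstar r) e sp b κ (star g) = gpos-consistent r (e ∘ star) (sp ∘ star) b κ g

  consistent : ∀ k q → Consistent k q
  consistent k (b , initial) = initial-consistent b k
  consistent k (b , at κ p) = pos-consistent φ id (λ _ → refl) b κ p k

-- Counting the states

length-map-++ : {A B C : Set} (f : A → C) (g : B → C) (xs : List A) (ys : List B) →
  length (map f xs ++ map g ys) ≡ length xs + length ys
length-map-++ f g xs ys = ≡.trans (length-++ (map f xs)) (cong₂ _+_ (length-map f xs) (length-map g ys))

length-cartesianProduct : {A B : Set} (xs : List A) (ys : List B) →
  length (cartesianProduct xs ys) ≡ length xs * length ys
length-cartesianProduct [] ys = refl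
length-cartesianProduct (x ∷ xs) ys =
  ≡.trans (length-++ (map (x ,_) ys)) (cong₂ _+_ (length-map (x ,_) ys) (length-cartesianProduct xs ys))

module Enumerated {A : Set} (xs : List A) (complete : ∀ x → x ∈ xs) where

  decode : Fin (length xs) → A
  decode = List.lookup xs

  encode : A → Fin (length xs)
  encode x = index (complete x)

  decode-encode : ∀ x → decode (encode x) ≡ x
  decode-encode x = sym (lookup-index (complete x))

allLeaves : (r : Guard n) → List (Leaf r)
allLeaves (gprop _) = letter ∷ []
allLeaves (gtest _) = []
allLeaves (gplus r s) = map plusˡ (allLeaves r) ++ map plusʳ (allLeaves s)
allLeaves (gseq r s) = map seqˡ (allLeaves r) ++ map seqʳ (allLeaves s)
allLeaves (gstar r) = map star (allLeaves r)

∈-allLeaves : {r : Guard n} (l : Leaf r) → l ∈ allLeaves r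
∈-allLeaves letter = here refl
∈-allLeaves (plusˡ l) = ∈-++⁺ˡ (∈-map⁺ plusˡ (∈-allLeaves l))
∈-allLeaves (plusʳ {r = r} l) = ∈-++⁺ʳ (map plusˡ (allLeaves r)) (∈-map⁺ plusʳ (∈-allLeaves l))
∈-allLeaves (seqˡ l) = ∈-++⁺ˡ (∈-map⁺ seqˡ (∈-allLeaves l))
∈-allLeaves (seqʳ {r = r} l) = ∈-++⁺ʳ (map seqˡ (allLeaves r)) (∈-map⁺ seqʳ (∈-allLeaves l))
∈-allLeaves (star l) = ∈-map⁺ star (∈-allLeaves l)

allLeaves-length : (r : Guard n) → length (allLeaves r) ≤ glen r
allLeaves-length (gprop _) = ≤-refl
allLeaves-length (gtest _) = z≤n
allLeaves-length (gplus r s) = ≤-trans (≤-reflexive (length-map-++ plusˡ plusʳ (allLeaves r) (allLeaves s)))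
  (m≤n⇒m≤1+n (+-mono-≤ (allLeaves-length r) (allLeaves-length s)))
allLeaves-length (gseq r s) = ≤-trans (≤-reflexive (length-map-++ seqˡ seqʳ (allLeaves r) (allLeaves s)))
  (m≤n⇒m≤1+n (+-mono-≤ (allLeaves-length r) (allLeaves-length s)))
allLeaves-length (gstar r) = ≤-trans (≤-reflexive (length-map star (allLeaves r)))
  (m≤n⇒m≤1+n (allLeaves-length r))

mutual
  allPos : (ψ : Formula n) → List (Pos ψ)
  allPos (atom p) = []
  allPos (neg a) = map inNeg (allPos a)
  allPos (conj a b) = map inConjˡ (allPos a) ++ map inConjʳ (allPos b)
  allPos (disj a b) = map inDisjˡ (allPos a) ++ map inDisjʳ (allPos b)
  allPos (impl a b) = map inImplˡ (allPos a) ++ map inImplʳ (allPos b)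
  allPos (dia r a) = map diaLeaf (allLeaves r) ++ map diaGuard (allGPos r) ++ map diaBody (allPos a)
  allPos (box r a) = map boxLeaf (allLeaves r) ++ map boxGuard (allGPos r) ++ map boxBody (allPos a)

  allGPos : (r : Guard n) → List (GPos r)
  allGPos (gprop _) = []
  allGPos (gtest ψ) = map inTest (allPos ψ)
  allGPos (gplus r s) = map plusˡ (allGPos r) ++ map plusʳ (allGPos s)
  allGPos (gseq r s) = map seqˡ (allGPos r) ++ map seqʳ (allGPos s)
  allGPos (gstar r) = map star (allGPos r)

mutual
  ∈-allPos : {ψ : Formula n} (p : Pos ψ) → p ∈ allPos ψ
  ∈-allPos (inNeg p) = ∈-map⁺ inNeg (∈-allPos p)
  ∈-allPos (inConjˡ p) = ∈-++⁺ˡ (∈-map⁺ inConjˡ (∈-allPos p))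
  ∈-allPos (inConjʳ {a = a} p) = ∈-++⁺ʳ (map inConjˡ (allPos a)) (∈-map⁺ inConjʳ (∈-allPos p))
  ∈-allPos (inDisjˡ p) = ∈-++⁺ˡ (∈-map⁺ inDisjˡ (∈-allPos p))
  ∈-allPos (inDisjʳ {a = a} p) = ∈-++⁺ʳ (map inDisjˡ (allPos a)) (∈-map⁺ inDisjʳ (∈-allPos p))
  ∈-allPos (inImplˡ p) = ∈-++⁺ˡ (∈-map⁺ inImplˡ (∈-allPos p))
  ∈-allPos (inImplʳ {a = a} p) = ∈-++⁺ʳ (map inImplˡ (allPos a)) (∈-map⁺ inImplʳ (∈-allPos p))
  ∈-allPos (diaLeaf l) = ∈-++⁺ˡ (∈-map⁺ diaLeaf (∈-allLeaves l))
  ∈-allPos (diaGuard {r = r} g) = ∈-++⁺ʳ (map diaLeaf (allLeaves r)) (∈-++⁺ˡ (∈-map⁺ diaGuard (∈-allGPos g)))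
  ∈-allPos (diaBody {r = r} p) =
    ∈-++⁺ʳ (map diaLeaf (allLeaves r)) (∈-++⁺ʳ (map diaGuard (allGPos r)) (∈-map⁺ diaBody (∈-allPos p)))
  ∈-allPos (boxLeaf l) = ∈-++⁺ˡ (∈-map⁺ boxLeaf (∈-allLeaves l))
  ∈-allPos (boxGuard {r = r} g) = ∈-++⁺ʳ (map boxLeaf (allLeaves r)) (∈-++⁺ˡ (∈-map⁺ boxGuard (∈-allGPos g)))
  ∈-allPos (boxBody {r = r} p) =
    ∈-++⁺ʳ (map boxLeaf (allLeaves r)) (∈-++⁺ʳ (map boxGuard (allGPos r)) (∈-map⁺ boxBody (∈-allPos p)))

  ∈-allGPos : {r : Guard n} (g : GPos r) → g ∈ allGPos r
  ∈-allGPos (inTest p) = ∈-map⁺ inTest (∈-allPos p)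
  ∈-allGPos (plusˡ g) = ∈-++⁺ˡ (∈-map⁺ plusˡ (∈-allGPos g))
  ∈-allGPos (plusʳ {r = r} g) = ∈-++⁺ʳ (map plusˡ (allGPos r)) (∈-map⁺ plusʳ (∈-allGPos g))
  ∈-allGPos (seqˡ g) = ∈-++⁺ˡ (∈-map⁺ seqˡ (∈-allGPos g))
  ∈-allGPos (seqʳ {r = r} g) = ∈-++⁺ʳ (map seqˡ (allGPos r)) (∈-map⁺ seqʳ (∈-allGPos g))
  ∈-allGPos (star g) = ∈-map⁺ star (∈-allGPos g)

mutual
  allPos-length : (ψ : Formula n) → length (allPos ψ) ≤ guardsLen ψ
  allPos-length (atom p) = z≤n
  allPos-length (neg a) = ≤-trans (≤-reflexive (length-map inNeg (allPos a))) (allPos-length a)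
  allPos-length (conj a b) = ≤-trans (≤-reflexive (length-map-++ inConjˡ inConjʳ (allPos a) (allPos b)))
    (+-mono-≤ (allPos-length a) (allPos-length b))
  allPos-length (disj a b) = ≤-trans (≤-reflexive (length-map-++ inDisjˡ inDisjʳ (allPos a) (allPos b)))
    (+-mono-≤ (allPos-length a) (allPos-length b))
  allPos-length (impl a b) = ≤-trans (≤-reflexive (length-map-++ inImplˡ inImplʳ (allPos a) (allPos b)))
    (+-mono-≤ (allPos-length a) (allPos-length b))
  allPos-length (dia r a) = modal-length r a diaLeaf diaGuard diaBody
  allPos-length (box r a) = modal-length r a boxLeaf boxGuard boxBody

  modal-length : {B : Set} (r : Guard n) (a : Formula n) (f : Leaf r → B) (g : GPos r → B) (h : Pos a → B) →
    length (map f (allLeaves r) ++ map g (allGPos r) ++ map h (allPos a)) ≤ glen r + guardsLenG r + guardsLen a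
  modal-length r a f g h = begin
    length (map f (allLeaves r) ++ map g (allGPos r) ++ map h (allPos a))
      ≡⟨ ≡.trans (length-++ (map f (allLeaves r)))
        (cong₂ _+_ (length-map f (allLeaves r)) (length-map-++ g h (allGPos r) (allPos a))) ⟩
    length (allLeaves r) + (length (allGPos r) + length (allPos a))
      ≤⟨ +-mono-≤ (allLeaves-length r) (+-mono-≤ (allGPos-length r) (allPos-length a)) ⟩
    glen r + (guardsLenG r + guardsLen a)
      ≡⟨ sym (+-assoc (glen r) (guardsLenG r) (guardsLen a)) ⟩
    glen r + guardsLenG r + guardsLen a ∎
    where open ≤-Reasoning

  allGPos-length : (r : Guard n) → length (allGPos r) ≤ guardsLenG r
  allGPos-length (gprop _) = z≤n
  allGPos-length (gtest ψ) = ≤-trans (≤-reflexive (length-map inTest (allPos ψ))) (allPos-length ψ)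
  allGPos-length (gplus r s) = ≤-trans (≤-reflexive (length-map-++ plusˡ plusʳ (allGPos r) (allGPos s)))
    (+-mono-≤ (allGPos-length r) (allGPos-length s))
  allGPos-length (gseq r s) = ≤-trans (≤-reflexive (length-map-++ seqˡ seqʳ (allGPos r) (allGPos s)))
    (+-mono-≤ (allGPos-length r) (allGPos-length s))
  allGPos-length (gstar r) = ≤-trans (≤-reflexive (length-map star (allGPos r))) (allGPos-length r)

allKinds : List Kind
allKinds = cartesianProduct (allFin 4) (cartesianProduct (sat ∷ unsat ∷ free ∷ []) (once ∷ often ∷ []))

∈-allKinds : (κ : Kind) → κ ∈ allKinds
∈-allKinds (i , c , m) = ∈-cartesianProduct⁺ (∈-allFin i) (∈-cartesianProduct⁺ (ending c) (mode m))
  where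
  ending : ∀ c → c ∈ sat ∷ unsat ∷ free ∷ []
  ending sat = here refl
  ending unsat = there (here refl)
  ending free = there (there (here refl))
  mode : ∀ m → m ∈ once ∷ often ∷ []
  mode once = here refl
  mode often = there (here refl)

allNodes : (φ : Formula n) → List (Node φ)
allNodes φ = initial ∷ map (λ (κ , p) → at κ p) (cartesianProduct allKinds (allPos φ))

∈-allNodes : {φ : Formula n} (v : Node φ) → v ∈ allNodes φ
∈-allNodes initial = here refl
∈-allNodes (at κ p) = there (∈-map⁺ (λ (κ , p) → at κ p) (∈-cartesianProduct⁺ (∈-allKinds κ) (∈-allPos p)))

allStates : (φ : Formula n) → List (Bool × Node φ)
allStates φ = cartesianProduct (true ∷ false ∷ []) (allNodes φ)

∈-allStates : {φ : Formula n} (q : Bool × Node φ) → q ∈ allStates φ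
∈-allStates (b , v) = ∈-cartesianProduct⁺ (bool b) (∈-allNodes v)
  where
  bool : ∀ b → b ∈ true ∷ false ∷ []
  bool true = here refl
  bool false = there (here refl)

allStates-length : (φ : Formula n) → length (allStates φ) ≡ 2 * suc (24 * length (allPos φ))
allStates-length φ = ≡.trans (length-cartesianProduct (true ∷ false ∷ []) (allNodes φ))
  (cong (λ m → 2 * suc m) (≡.trans (length-map _ (cartesianProduct allKinds (allPos φ)))
                                   (length-cartesianProduct allKinds (allPos φ))))

guardsLen<size : (φ : Formula n) → suc (guardsLen φ) ≤ size φ
guardsLen<size φ = +-monoˡ-≤ (guardsLen φ) (nonempty φ)
  where
  nonempty : (φ : Formula n) → 1 ≤ length (deduplicateᵇ eqF (subs φ))
  nonempty (atom _) = s≤s z≤n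
  nonempty (neg _) = s≤s z≤n
  nonempty (conj _ _) = s≤s z≤n
  nonempty (disj _ _) = s≤s z≤n
  nonempty (impl _ _) = s≤s z≤n
  nonempty (dia _ _) = s≤s z≤n
  nonempty (box _ _) = s≤s z≤n

allStates-bound : (φ : Formula n) → length (allStates φ) ≤ 48 * size φ
allStates-bound φ = begin
  length (allStates φ)               ≡⟨ allStates-length φ ⟩
  2 * suc (24 * length (allPos φ))   ≡⟨ *-suc 2 (24 * length (allPos φ)) ⟩
  2 + 2 * (24 * length (allPos φ))   ≡⟨ cong (2 +_) (sym (*-assoc 2 24 (length (allPos φ)))) ⟩
  2 + 48 * length (allPos φ)         ≤⟨ +-monoˡ-≤ (48 * length (allPos φ)) {2} {48} (s≤s (s≤s z≤n)) ⟩
  48 + 48 * length (allPos φ)        ≡⟨ sym (*-suc 48 (length (allPos φ))) ⟩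
  48 * suc (length (allPos φ))       ≤⟨ *-monoʳ-≤ 48 (≤-trans (s≤s (allPos-length φ)) (guardsLen<size φ)) ⟩
  48 * size φ                        ∎
  where open ≤-Reasoning

module Construction {n : ℕ} (φ : Formula n) (β : B4) where
  open Automaton φ β
  open Enumerated (allStates φ) ∈-allStates public

  𝔄 : APA n
  𝔄 = record
    { states = length (allStates φ)
    ; qinit = encode (true , initial)
    ; δ = λ q a → rename encode (δState (decode q) a)
    ; Ω = colour ∘ decode }

  dualState-involutive : ∀ q → dualState (dualState q) ≡ q
  dualState-involutive (b , v) = cong (_, v) (not-involutive b)

  δState-dual : ∀ q a (S P : State → Bool) → S ⊩ δState q a → P ⊩ δState (dualState q) a →
    ∃[ q' ] (T (S q') × T (P (dualState q')))
  δState-dual (true , v) a S P s p = ⊩-dual-meet dualState S P (δNode v a) s p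
  δState-dual (false , v) a S P s p with ⊩-dual-meet dualState P S (δNode v a) p s
  ... | q' , p' , s' = dualState q' , s' , subst (T ∘ P) (sym (dualState-involutive q')) p'

  colour-dual : ∀ q → Even (colour (dualState q)) → ¬ Even (colour q)
  colour-dual (true , initial) e = ⊥-elim (¬Even-1 e)
  colour-dual (true , at (_ , _ , once) _) _ = ¬Even-1
  colour-dual (true , at (_ , _ , often) _) e = ⊥-elim (¬Even-1 e)
  colour-dual (false , initial) _ = ¬Even-1
  colour-dual (false , at (_ , _ , once) _) e = ⊥-elim (¬Even-1 e)
  colour-dual (false , at (_ , _ , often) _) _ = ¬Even-1

module Recognition (em : ExcludedMiddle 0ℓ) {n : ℕ} (φ : Formula n) (β : B4) (w : Trace n) where
  open Automaton φ β
  open Construction φ β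
  open Correctness em φ β w using (holds; holds⇔)
  open Consistency em φ β w using (Good; progress; consistent)

  module Criterion = AcceptanceCriterion em 𝔄 w
    (λ k → holds k ∘ decode) (encode ∘ dualState ∘ decode) (rank ∘ decode) (λ k → progress k ∘ decode)

  init-or-dual : ¬ T (holds 0 (decode (encode (true , initial)))) →
    T (holds 0 (decode (encode (dualState (decode (encode (true , initial)))))))
  init-or-dual ¬h rewrite decode-encode (true , initial) | decode-encode (false , initial) = from (T-not _) ¬h

  δ-dual : ∀ k q (S P : Fin (states 𝔄) → Bool) →
    S ⊩ δ 𝔄 q (w k) → P ⊩ δ 𝔄 (encode (dualState (decode q))) (w k) →
    ∃[ q' ] (T (S q') × T (P (encode (dualState (decode q')))))
  δ-dual k q S P s p with δState-dual (decode q) (w k) (S ∘ encode) (P ∘ encode)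
    (to (⊩-rename encode S (δState (decode q) (w k))) s)
    (subst (λ q̂ → (P ∘ encode) ⊩ δState q̂ (w k)) (decode-encode (dualState (decode q)))
      (to (⊩-rename encode P (δState (decode (encode (dualState (decode q)))) (w k))) p))
  ... | q' , s' , p' = encode q' , s' , subst (λ q̂ → T (P (encode (dualState q̂)))) (sym (decode-encode q')) p'

  Ω-dual : ∀ q → Even (Ω 𝔄 (encode (dualState (decode q)))) → ¬ Even (Ω 𝔄 q)
  Ω-dual q e = colour-dual (decode q) (subst (Even ∘ colour) (decode-encode (dualState (decode q))) e)

  consistent′ : ∀ k q → T (holds k (decode q)) → Criterion.good k q ⊩ δ 𝔄 q (w k)
  consistent′ k q h = from (⊩-rename encode (Criterion.good k q) (δState (decode q) (w k)))
    (consistent k (decode q) h _ λ q' g → fromWitness (subst (Good k (decode q)) (sym (decode-encode q')) g))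

  accepts⇔ : Accepts 𝔄 w ⇔ (w ⊨ φ ⪰ β)
  accepts⇔ = ⇔-trans (Criterion.accepts⇔holds init-or-dual δ-dual Ω-dual consistent′)
    (subst (λ q → T (holds 0 q) ⇔ (w ⊨ φ ⪰ β)) (sym (decode-encode (true , initial))) (holds⇔ 0 initial))

lemma4 : ExcludedMiddle 0ℓ → (n : ℕ) → 1 ≤ n →
    ∃[ c ] ((φ : Formula n) (β : B4) →
      Σ (APA n) λ A → states A ≤ c * size φ
        × ((w : Trace n) → Accepts A w ⇔ (w ⊨ φ ⪰ β)))
lemma4 em n _ = 48 , λ φ β → Construction.𝔄 φ β , allStates-bound φ , Recognition.accepts⇔ em φ β
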